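{- Let $\Gamma$ be a connected strongly regular graph. Then $\Gamma$ admits perfect state transfer (for the Grover walk) if and only if $\Gamma$ is isomorphic to the complete bipartite graph $K_{2,2}$ or to the complete tripartite graph $K_{2,2,2}$.
   Context: Graphs are finite and simple, with every vertex of positive degree. A graph $\Gamma=(V,E)$ on $n$ vertices is strongly regular with parameters $(n,k,\lambda,\mu)$ if it is neither complete nor edgeless, it is $k$-regular, any two adjacent vertices have exactly $\lambda$ common neighbours, and any two distinct non-adjacent vertices have exactly $\mu$ common neighbours. Grover walk: let $\mathcal{A}=\{(x,y),(y,x)\mid \{x,y\}\in E\}$ be the set of arcs; for $a=(x,y)$ write $o(a)=x$, $t(a)=y$, $a^{ -1}=(y,x)$. The boundary matrix $d\in\mathbb{C}^{V\times\mathcal{A}}$ is $d_{x,a}=\frac{1}{\sqrt{\deg x}}\delta_{x,t(a)}$, the shift matrix $R\in\mathbb{C}^{\mathcal{A}\times\mathcal{A}}$ is $R_{a,b}=\delta_{a,b^{ -1}}$, and the time evolution matrix is $U=R(2d^*d-I)$. For $x\in V$ let $e_x\in\mathbb{C}^V$ be the standard unit vector. For distinct unit vectors $\Phi,\Psi\in\mathbb{C}^{\mathcal{A}}$, perfect state transfer occurs from $\Phi$ to $\Psi$ at time $\tau\in\mathbb{Z}_{\ge1}$ if $U^\tau\Phi=\gamma\Psi$ for some $\gamma\in\mathbb{C}$ with $|\gamma|=1$. The graph $\Gamma$ admits perfect state transfer if perfect state transfer occurs from $d^*e_x$ to $d^*e_y$ at some time $\tau\ge1$ for some pair of distinct vertices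 $x\neq y$. -}

module Defs where

open import Data.Nat as ℕ using (ℕ; zero; suc; _<_; _≤_; _%_; _≡ᵇ_)
open import Data.Integer using (+_)
open import Data.Rational using (ℚ; 0ℚ; 1ℚ; _/_; _+_; _*_; _-_)
open import Data.Fin using (Fin; toℕ)
open import Data.Fin.Properties using () renaming (_≟_ to _≟ᶠ_)
open import Data.Bool using (Bool; true; false; not; _∧_; if_then_else_)
open import Data.Product using (Σ; ∃; ∃-syntax; _×_; _,_; proj₁; proj₂)
open import Relation.Binary.PropositionalEquality using (_≡_; _≢_; refl; sym; trans)
open import Relation.Nullary using (¬_; Dec; yes; no)
open import Relation.Nullary.Decidable using (⌊_⌋)
open import Function.Bundles using (_↔_; Inverse)

record Graph (n : ℕ) : Set where
  field
    adj    : Fin n → Fin n → Bool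
    symm   : ∀ x y → adj x y ≡ adj y x
    irrefl : ∀ x → adj x x ≡ false
open Graph public

sumℕ : ∀ {n} → (Fin n → ℕ) → ℕ
sumℕ {zero}  f = 0
sumℕ {suc n} f = f Data.Fin.zero ℕ.+ sumℕ (λ i → f (Data.Fin.suc i))

sumℚ : ∀ {n} → (Fin n → ℚ) → ℚ
sumℚ {zero}  f = 0ℚ
sumℚ {suc n} f = f Data.Fin.zero + sumℚ (λ i → f (Data.Fin.suc i))

b2n : Bool → ℕ
b2n true  = 1
b2n false = 0

b2q : Bool → ℚ
b2q true  = 1ℚ
b2q false = 0ℚ

ℕtoℚ : ℕ → ℚ
ℕtoℚ k = (+ k) / 1

-- 1/k for k ≥ 1 (and 0 for k = 0, never used since degrees are positive)
recip : ℕ → ℚ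
recip zero    = 0ℚ
recip (suc k) = (+ 1) / suc k

_==_ : ∀ {n} → Fin n → Fin n → Bool
x == y = ⌊ x ≟ᶠ y ⌋

module _ {n : ℕ} (G : Graph n) where

  deg : Fin n → ℕ
  deg x = sumℕ (λ y → b2n (adj G x y))

  common : Fin n → Fin n → ℕ
  common x y = sumℕ (λ z → b2n (adj G x z ∧ adj G y z))

  data Reach : Fin n → Fin n → Set where
    here : ∀ {x} → Reach x x
    step : ∀ {x y z} → adj G x y ≡ true → Reach y z → Reach x z

  Connected : Set
  Connected = ∀ x y → Reach x y

  IsSRG : ℕ → ℕ → ℕ → Set
  IsSRG k l m =
      (∃[ x ] ∃[ y ] (x ≢ y × adj G x y ≡ false))
    × (∃[ x ] ∃[ y ] (adj G x y ≡ true))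
    × (∀ x → deg x ≡ k)
    × (∀ x y → adj G x y ≡ true → common x y ≡ l)
    × (∀ x y → x ≢ y → adj G x y ≡ false → common x y ≡ m)

  StronglyRegular : Set
  StronglyRegular = ∃[ k ] ∃[ l ] ∃[ m ] IsSRG k l m

  Arc : Set
  Arc = Σ (Fin n × Fin n) (λ p → adj G (proj₁ p) (proj₂ p) ≡ true)

  o t : Arc → Fin n
  o a = proj₁ (proj₁ a)
  t a = proj₂ (proj₁ a)

  inv : Arc → Arc
  inv ((x , y) , p) = (y , x) , trans (symm G y x) p

  -- vectors and matrices indexed by arcs (entries in ℚ; all entries of
  -- the Grover walk matrix are rational)
  Vecᴬ : Set
  Vecᴬ = Arc → ℚ

  Matᴬ : Set
  Matᴬ = Arc → Arc → ℚ

  arcTerm : (b : Bool) → (b ≡ true → ℚ) → ℚ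
  arcTerm true  f = f refl
  arcTerm false f = 0ℚ

  sumArc : (Arc → ℚ) → ℚ
  sumArc f = sumℚ (λ x → sumℚ (λ y → arcTerm (adj G x y) (λ p → f ((x , y) , p))))

  sameArc : Arc → Arc → Bool
  sameArc a b = (o a == o b) ∧ (t a == t b)

  _·ᴹ_ : Matᴬ → Matᴬ → Matᴬ
  (A ·ᴹ B) a b = sumArc (λ c → A a c * B c b)

  _·ᵛ_ : Matᴬ → Vecᴬ → Vecᴬ
  (A ·ᵛ v) a = sumArc (λ c → A a c * v c)

  Iᴬ : Matᴬ
  Iᴬ a b = b2q (sameArc a b)

  Rᴬ : Matᴬ
  Rᴬ a b = b2q (sameArc a (inv b))

  -- d* d, where d_{x,a} = δ_{x,t(a)} / √deg x :
  -- (d* d)_{a,b} = Σ_x d_{x,a} d_{x,b} = δ_{t(a),t(b)} / deg t(a)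
  dd : Matᴬ
  dd a b = b2q (t a == t b) * recip (deg (t a))

  Uᴬ : Matᴬ
  Uᴬ = Rᴬ ·ᴹ (λ a b → (ℕtoℚ 2 * dd a b) - Iᴬ a b)

  Upow : ℕ → Vecᴬ → Vecᴬ
  Upow zero    v = v
  Upow (suc τ) v = Uᴬ ·ᵛ Upow τ v

  -- χ_x = √(deg x) · d* e_x , i.e. (χ_x)_a = δ_{x,t(a)}
  χ : Fin n → Vecᴬ
  χ x a = b2q (t a == x)

  -- Perfect state transfer from d*e_x to d*e_y at time τ:
  --   U^τ d*e_x = γ d*e_y with |γ| = 1.
  -- Equivalently: U^τ χ_x = c χ_y for a rational c with
  -- c² · deg y = deg x  (c = γ √(deg x / deg y), necessarily real).
  PSTat : Fin n → Fin n → ℕ → Set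
  PSTat x y τ = ∃[ c ] ((c * c * ℕtoℚ (deg y) ≡ ℕtoℚ (deg x))
                        × (∀ a → Upow τ (χ x) a ≡ c * χ y a))

  AdmitsPST : Set
  AdmitsPST = ∃[ x ] ∃[ y ] (x ≢ y × ∃[ τ ] (1 ≤ τ × PSTat x y τ))

IsomorphicTo : ∀ {n m} → Graph n → (Fin m → Fin m → Bool) → Set
IsomorphicTo {n} {m} G H =
  Σ (Fin n ↔ Fin m) λ f → ∀ x y → adj G x y ≡ H (Inverse.to f x) (Inverse.to f y)

multipartite : ∀ {m} (p : ℕ) .{{_ : ℕ.NonZero p}} → Fin m → Fin m → Bool
multipartite p x y = not ((toℕ x % p) ≡ᵇ (toℕ y % p))

K22 : Fin 4 → Fin 4 → Bool
K22 = multipartite 2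

K222 : Fin 6 → Fin 6 → Bool
K222 = multipartite 3

-- Around a vertex x of a strongly regular graph the partition {x}, N(x), rest is equitable, so
-- the Grover walk started at χ_x stays among arc vectors a ↦ F (t a) + H (o a) with F and H
-- constant on the three cells.  If it reaches c χ_y at time τ, summing over the arcs into each
-- vertex shows that k F + A H, again cell-constant, is a nonzero multiple of δ_y; so the cell of
-- y is {y}.  Since a connected 1-regular graph is complete, y is the unique non-neighbour of x,
-- and the graph is a cocktail party graph on k + 2 vertices.  There the cell functional
-- φ = self − 2 near + far belongs to the adjacency eigenvalue −2, and along the walk it produces
-- the Lucas sequence 2 cos (t θ) with 2 cos θ = −4/k, which must equal ±2 at time τ.  By Niven's
-- argument this forces −4/k ∈ ℤ, so k ∈ {2, 4}: K_{2,2} or K_{2,2,2}.  Conversely, in these two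
-- graphs the same recursion shows transfer from every vertex to its mate at time 2, resp. 6.

module Submission where

open import Defs
open import Level using (0ℓ)
open import Function using (_∘_)
open import Function.Bundles using (_↔_; _⇔_; Inverse; mk↔ₛ′; mk⇔)
open import Relation.Binary.PropositionalEquality
open import Relation.Nullary using (¬?; Dec; yes; no; contradiction)
open import Relation.Nullary.Decidable using (dec⇒maybe; from-yes)
open import Data.Product using (∃; ∃-syntax; _×_; _,_; proj₁; proj₂)
open import Data.Sum as Sum using (_⊎_; inj₁; inj₂; [_,_]′; reduce)
open import Data.Bool as Bool using (Bool; true; false; not; _∧_; _∨_)
open import Data.Bool.Properties using (∧-comm; ∧-inverseʳ; ∨-inverseʳ; ∧-zeroʳ; ∧-idem; not-injective)
open import Data.Bool.ListAction using (any)
open import Data.List using (List; []; _∷_; length)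
open import Data.List.Relation.Unary.All using (All; []; _∷_)
open import Data.List.Relation.Unary.AllPairs using ([]; _∷_)
open import Data.List.Relation.Unary.Unique.Propositional using (Unique)
open import Data.Nat as ℕ using (ℕ; zero; suc; _≤_; _<_; z≤n; s≤s)
import Data.Nat.Properties as ℕP
open import Data.Nat.DivMod using (_%_; m%n<n; m≡m%n+[m/n]*n)
open import Data.Nat.Divisibility using (∣1⇒≡1) renaming (_∣_ to _∣ₙ_)
open import Data.Nat.Coprimality using (Coprime; coprime-+; coprime?; coprime-divisor; 1-coprimeTo)
import Data.Nat.Coprimality as Coprimality
open import Data.Integer as ℤ using (ℤ; +_)
import Data.Integer.Properties as ℤP
open import Data.Integer.Divisibility.Signed using (divides; ∣-refl; ∣m∣n⇒∣m-n; ∣n⇒∣m*n; ∣m⇒∣m*n; ∣⇒∣ᵤ)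
  renaming (_∣_ to _∣ℤ_)
open import Data.Rational as ℚ using (ℚ; 0ℚ; 1ℚ; _/_; _+_; _*_; _-_; -_; toℚᵘ)
import Data.Rational.Properties as ℚP
open import Data.Rational.Literals using (fromℤ)
open import Data.Rational.Unnormalised as ℚᵘ using (mkℚᵘ)
import Data.Rational.Unnormalised.Properties as ℚᵘP
open import Data.Fin as Fin using (Fin; zero; suc; splitAt; join)
open import Data.Fin.Properties using (suc-injective; any?; all?; injective⇒≤; join-splitAt)
  renaming (_≟_ to _≟ᶠ_)
import Algebra.Properties.Group as GroupProperties
import Tactic.RingSolver.Core.AlmostCommutativeRing as ACR
open import Tactic.RingSolver using (solve-∀)
open import Data.Nat.Tactic.RingSolver using () renaming (solve-∀ to ℕ-solve-∀)
open import Data.Integer.Tactic.RingSolver using () renaming (solve-∀ to ℤ-solve-∀)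

ℚ-ring : ACR.AlmostCommutativeRing 0ℓ 0ℓ
ℚ-ring = ACR.fromCommutativeRing ℚP.+-*-commutativeRing (λ q → dec⇒maybe (0ℚ ℚP.≟ q))

ℤtoℚ : ℤ → ℚ
ℤtoℚ i = i / 1

ℤtoℚ≡fromℤ : ∀ i → ℤtoℚ i ≡ fromℤ i
ℤtoℚ≡fromℤ i = ℚP.↥p/↧p≡p (fromℤ i)

ℤtoℚ-+ : ∀ i j → ℤtoℚ (i ℤ.+ j) ≡ ℤtoℚ i + ℤtoℚ j
ℤtoℚ-+ i j = begin
  (i ℤ.+ j) / 1                    ≡⟨ cong (_/ 1) (cong₂ ℤ._+_ (ℤP.*-identityʳ i) (ℤP.*-identityʳ j)) ⟨
  (i ℤ.* + 1 ℤ.+ j ℤ.* + 1) / 1    ≡⟨ cong₂ _+_ (ℤtoℚ≡fromℤ i) (ℤtoℚ≡fromℤ j) ⟨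
  ℤtoℚ i + ℤtoℚ j                  ∎
  where open ≡-Reasoning

ℤtoℚ-* : ∀ i j → ℤtoℚ (i ℤ.* j) ≡ ℤtoℚ i * ℤtoℚ j
ℤtoℚ-* i j = sym (cong₂ _*_ (ℤtoℚ≡fromℤ i) (ℤtoℚ≡fromℤ j))

ℤtoℚ-neg : ∀ i → ℤtoℚ (ℤ.- i) ≡ - ℤtoℚ i
ℤtoℚ-neg i = inverseˡ-unique (ℤtoℚ (ℤ.- i)) (ℤtoℚ i)
  (trans (sym (ℤtoℚ-+ (ℤ.- i) i)) (cong ℤtoℚ (ℤP.+-inverseˡ i)))
  where open GroupProperties ℚP.+-0-group

ℤtoℚ-injective : ∀ {i j} → ℤtoℚ i ≡ ℤtoℚ j → i ≡ j
ℤtoℚ-injective {i} {j} eq = cong ℚ.numerator (trans (sym (ℤtoℚ≡fromℤ i)) (trans eq (ℤtoℚ≡fromℤ j)))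

ℕtoℚ-+ : ∀ a b → ℕtoℚ (a ℕ.+ b) ≡ ℕtoℚ a + ℕtoℚ b
ℕtoℚ-+ a b = ℤtoℚ-+ (+ a) (+ b)

ℕtoℚ-* : ∀ a b → ℕtoℚ (a ℕ.* b) ≡ ℕtoℚ a * ℕtoℚ b
ℕtoℚ-* a b = trans (cong ℤtoℚ (ℤP.pos-* a b)) (ℤtoℚ-* (+ a) (+ b))

recip-inverse : ∀ m → recip (suc m) * ℕtoℚ (suc m) ≡ 1ℚ
recip-inverse m = ℚP.toℚᵘ-injective (begin
  toℚᵘ (recip (suc m) * ℕtoℚ (suc m))
    ≈⟨ ℚP.toℚᵘ-homo-* (recip (suc m)) (ℕtoℚ (suc m)) ⟩
  toℚᵘ (recip (suc m)) ℚᵘ.* toℚᵘ (ℕtoℚ (suc m))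
    ≈⟨ ℚᵘP.*-cong (ℚP.toℚᵘ-fromℚᵘ (mkℚᵘ (+ 1) m)) (ℚP.toℚᵘ-fromℚᵘ (mkℚᵘ (+ suc m) 0)) ⟩
  mkℚᵘ (+ 1) m ℚᵘ.* mkℚᵘ (+ suc m) 0
    ≈⟨ ℚᵘP.*-inverseˡ (mkℚᵘ (+ suc m) 0) ⟩
  ℚᵘ.1ℚᵘ ∎)
  where open ℚᵘP.≃-Reasoning

-- Lucas sequences and rational cosines

-- lucas u t = 2 cos (t θ) when u = 2 cos θ.
lucas : ℚ → ℕ → ℚ
lucas u zero          = ℕtoℚ 2
lucas u (suc zero)    = u
lucas u (suc (suc t)) = u * lucas u (suc t) - lucas u t

pair-recurrence⇒lucas : ∀ u (α β : ℕ → ℚ) → α 0 ≡ 1ℚ → β 0 ≡ 0ℚ →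
  (∀ t → α (suc t) ≡ - β t) → (∀ t → β (suc t) ≡ α t + u * β t) → ∀ t → α t + β (suc t) ≡ lucas u t
pair-recurrence⇒lucas u α β α₀ β₀ α-rec β-rec = agree
  where
  recurrence : ∀ a₀ b₀ a₁ b₁ a₂ b₂ b₃ → b₁ ≡ a₀ + u * b₀ → a₁ ≡ - b₀ → b₂ ≡ a₁ + u * b₁ →
               a₂ ≡ - b₁ → b₃ ≡ a₂ + u * b₂ → a₂ + b₃ ≡ u * (a₁ + b₂) - (a₀ + b₁)
  recurrence a₀ b₀ _ _ _ _ _ refl refl refl refl refl = identity u a₀ b₀
    where
    identity : ∀ u a₀ b₀ → - (a₀ + u * b₀) + (- (a₀ + u * b₀) + u * (- b₀ + u * (a₀ + u * b₀)))
                         ≡ u * (- b₀ + (- b₀ + u * (a₀ + u * b₀))) - (a₀ + (a₀ + u * b₀))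
    identity = solve-∀ ℚ-ring
  agree : ∀ t → α t + β (suc t) ≡ lucas u t
  agree zero = begin
    α 0 + β 1                     ≡⟨ cong (_+_ (α 0)) (β-rec 0) ⟩
    α 0 + (α 0 + u * β 0)         ≡⟨ cong₂ (λ a b → a + (a + u * b)) α₀ β₀ ⟩
    1ℚ + (1ℚ + u * 0ℚ)            ≡⟨ two u ⟩
    ℕtoℚ 2                        ∎
    where
    open ≡-Reasoning
    two : ∀ u → 1ℚ + (1ℚ + u * 0ℚ) ≡ ℕtoℚ 2
    two = solve-∀ ℚ-ring
  agree (suc zero) = begin
    α 1 + β 2                             ≡⟨ cong₂ _+_ (α-rec 0) (β-rec 1) ⟩
    - β 0 + (α 1 + u * β 1)               ≡⟨ cong (λ a → - β 0 + (a + u * β 1)) (α-rec 0) ⟩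
    - β 0 + (- β 0 + u * β 1)             ≡⟨ cong (λ b → - β 0 + (- β 0 + u * b)) (β-rec 0) ⟩
    - β 0 + (- β 0 + u * (α 0 + u * β 0)) ≡⟨ cong₂ (λ a b → - b + (- b + u * (a + u * b))) α₀ β₀ ⟩
    - 0ℚ + (- 0ℚ + u * (1ℚ + u * 0ℚ))     ≡⟨ one u ⟩
    u                                     ∎
    where
    open ≡-Reasoning
    one : ∀ u → - 0ℚ + (- 0ℚ + u * (1ℚ + u * 0ℚ)) ≡ u
    one = solve-∀ ℚ-ring
  agree (suc (suc t)) =
    trans (recurrence (α t) (β t) (α (suc t)) (β (suc t)) (α (suc (suc t))) (β (suc (suc t))) (β (suc (suc (suc t))))
                (β-rec t) (α-rec t) (β-rec (suc t)) (α-rec (suc t)) (β-rec (suc (suc t))))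
          (cong₂ (λ a b → u * a - b) (agree (suc t)) (agree t))

module LucasIntegral (p q : ℕ) where

  P : ℤ
  P = ℤ.- (+ p)

  lucasℤ : ℕ → ℤ
  lucasℤ zero          = + 2
  lucasℤ (suc zero)    = P
  lucasℤ (suc (suc t)) = P ℤ.* lucasℤ (suc t) ℤ.- + q ℤ.* + q ℤ.* lucasℤ t

  lucas-scaled : ∀ {u} → ℕtoℚ q * u ≡ - ℕtoℚ p → ∀ t → ℕtoℚ (q ℕ.^ t) * lucas u t ≡ ℤtoℚ (lucasℤ t)
  lucas-scaled {u} qu≡-p zero          = ℚP.*-identityˡ (ℕtoℚ 2)
  lucas-scaled {u} qu≡-p (suc zero)    = trans (cong (_* u) (cong ℕtoℚ (ℕP.*-identityʳ q))) (trans qu≡-p (sym (ℤtoℚ-neg (+ p))))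
  lucas-scaled {u} qu≡-p (suc (suc t)) = begin
    ℕtoℚ (q ℕ.^ suc (suc t)) * (u * L₁ - L₀)
      ≡⟨ cong (_* (u * L₁ - L₀)) (trans (ℕtoℚ-* q (q ℕ.* q ℕ.^ t)) (cong (Q *_) (ℕtoℚ-* q (q ℕ.^ t)))) ⟩
    Q * (Q * Qᵗ) * (u * L₁ - L₀)
      ≡⟨ regroup Q Qᵗ u L₁ L₀ ⟩
    Q * u * (Q * Qᵗ * L₁) - Q * Q * (Qᵗ * L₀)
      ≡⟨ cong₂ (λ a b → a * b - Q * Q * (Qᵗ * L₀)) qu≡-p (cong (_* L₁) (sym (ℕtoℚ-* q (q ℕ.^ t)))) ⟩
    - ℕtoℚ p * (ℕtoℚ (q ℕ.^ suc t) * L₁) - Q * Q * (Qᵗ * L₀)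
      ≡⟨ cong₂ (λ a b → - ℕtoℚ p * a - Q * Q * b) (lucas-scaled qu≡-p (suc t)) (lucas-scaled qu≡-p t) ⟩
    - ℕtoℚ p * ℤtoℚ (lucasℤ (suc t)) - Q * Q * ℤtoℚ (lucasℤ t)
      ≡⟨ homomorphism ⟨
    ℤtoℚ (lucasℤ (suc (suc t)))                                ∎
    where
    open ≡-Reasoning
    Q = ℕtoℚ q
    Qᵗ = ℕtoℚ (q ℕ.^ t)
    L₀ = lucas u t
    L₁ = lucas u (suc t)
    regroup : ∀ Q Qᵗ u L₁ L₀ → Q * (Q * Qᵗ) * (u * L₁ - L₀) ≡ Q * u * (Q * Qᵗ * L₁) - Q * Q * (Qᵗ * L₀)
    regroup = solve-∀ ℚ-ring
    homomorphism : ℤtoℚ (lucasℤ (suc (suc t))) ≡ - ℕtoℚ p * ℤtoℚ (lucasℤ (suc t)) - Q * Q * ℤtoℚ (lucasℤ t)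
    homomorphism = begin
      ℤtoℚ (P ℤ.* lucasℤ (suc t) ℤ.+ ℤ.- (+ q ℤ.* + q ℤ.* lucasℤ t))
        ≡⟨ ℤtoℚ-+ (P ℤ.* lucasℤ (suc t)) (ℤ.- (+ q ℤ.* + q ℤ.* lucasℤ t)) ⟩
      ℤtoℚ (P ℤ.* lucasℤ (suc t)) + ℤtoℚ (ℤ.- (+ q ℤ.* + q ℤ.* lucasℤ t))
        ≡⟨ cong₂ _+_ (trans (ℤtoℚ-* P (lucasℤ (suc t))) (cong (_* ℤtoℚ (lucasℤ (suc t))) (ℤtoℚ-neg (+ p))))
                     (trans (ℤtoℚ-neg (+ q ℤ.* + q ℤ.* lucasℤ t))
                            (cong -_ (trans (ℤtoℚ-* (+ q ℤ.* + q) (lucasℤ t))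
                                            (cong (_* ℤtoℚ (lucasℤ t)) (ℤtoℚ-* (+ q) (+ q)))))) ⟩
      - ℕtoℚ p * ℤtoℚ (lucasℤ (suc t)) - Q * Q * ℤtoℚ (lucasℤ t) ∎

  lucasℤ-congruence : ∀ t → + q ∣ℤ lucasℤ (suc t) ℤ.- P ℤ.^ suc t
  lucasℤ-congruence zero    = divides (+ 0) (trans (cong (ℤ._-_ P) (ℤP.*-identityʳ P)) (ℤP.+-inverseʳ P))
  lucasℤ-congruence (suc t) = subst (+ q ∣ℤ_) (sym (regroup P (+ q) (lucasℤ (suc t)) (lucasℤ t) (P ℤ.^ suc t)))
    (∣m∣n⇒∣m-n (∣n⇒∣m*n P (lucasℤ-congruence t)) (∣m⇒∣m*n (+ q ℤ.* lucasℤ t) ∣-refl))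
    where
    regroup : ∀ P Q E₁ E₀ A → P ℤ.* E₁ ℤ.- Q ℤ.* Q ℤ.* E₀ ℤ.- P ℤ.* A ≡ P ℤ.* (E₁ ℤ.- A) ℤ.- Q ℤ.* (Q ℤ.* E₀)
    regroup = ℤ-solve-∀

  abs-P^ : ∀ t → ℤ.∣ P ℤ.^ t ∣ ≡ p ℕ.^ t
  abs-P^ zero    = refl
  abs-P^ (suc t) = trans (ℤP.abs-* P (P ℤ.^ t)) (cong₂ ℕ._*_ (ℤP.∣-i∣≡∣i∣ (+ p)) (abs-P^ t))

coprime-cancel-^ : ∀ {q p} → Coprime q p → ∀ k {c} → q ∣ₙ p ℕ.^ k ℕ.* c → q ∣ₙ c
coprime-cancel-^ coprime zero    {c} q∣c = subst (_ ∣ₙ_) (ℕP.*-identityˡ c) q∣c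
coprime-cancel-^ {q} {p} coprime (suc k) {c} q∣ = coprime-cancel-^ coprime k
  (coprime-divisor coprime (subst (q ∣ₙ_) (ℕP.*-assoc p (p ℕ.^ k) c) q∣))

-- Niven's argument: for u = − p / q in lowest terms, q^t · lucas u t is an integer congruent to
-- (− p)^t modulo q, so its square is not 4 q^(2t) unless q = 1.
lucas-square≢4 : ∀ {p q u} → 2 ≤ q → Coprime q p → ℕtoℚ q * u ≡ - ℕtoℚ p →
                 ∀ t → lucas u (suc t) * lucas u (suc t) ≢ ℕtoℚ 4
lucas-square≢4 {p} {q} {u} 2≤q coprime qu≡-p t L²≡4 = contradiction (∣1⇒≡1 q∣1) λ { refl → ℕP.<-irrefl refl 2≤q }
  where
  open LucasIntegral p q
  τ = suc t
  E = lucasℤ τ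
  A = P ℤ.^ τ
  L = lucas u τ
  Qτ = ℕtoℚ (q ℕ.^ τ)
  E²≡ : E ℤ.* E ≡ + (q ℕ.^ t ℕ.* q ℕ.^ τ ℕ.* 4) ℤ.* + q
  E²≡ = ℤtoℚ-injective (begin
    ℤtoℚ (E ℤ.* E)                                   ≡⟨ ℤtoℚ-* E E ⟩
    ℤtoℚ E * ℤtoℚ E                                  ≡⟨ cong₂ _*_ (lucas-scaled qu≡-p τ) (lucas-scaled qu≡-p τ) ⟨
    Qτ * L * (Qτ * L)                                ≡⟨ square Qτ L ⟩
    Qτ * Qτ * (L * L)                                ≡⟨ cong (Qτ * Qτ *_) L²≡4 ⟩
    Qτ * Qτ * ℕtoℚ 4                                 ≡⟨ cong (_* ℕtoℚ 4) (ℕtoℚ-* (q ℕ.^ τ) (q ℕ.^ τ)) ⟨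
    ℕtoℚ (q ℕ.^ τ ℕ.* q ℕ.^ τ) * ℕtoℚ 4              ≡⟨ ℕtoℚ-* (q ℕ.^ τ ℕ.* q ℕ.^ τ) 4 ⟨
    ℕtoℚ (q ℕ.^ τ ℕ.* q ℕ.^ τ ℕ.* 4)                 ≡⟨ cong ℕtoℚ (shuffle q (q ℕ.^ t) (q ℕ.^ τ)) ⟩
    ℕtoℚ (q ℕ.^ t ℕ.* q ℕ.^ τ ℕ.* 4 ℕ.* q)           ≡⟨ cong ℤtoℚ (ℤP.pos-* (q ℕ.^ t ℕ.* q ℕ.^ τ ℕ.* 4) q) ⟩
    ℤtoℚ (+ (q ℕ.^ t ℕ.* q ℕ.^ τ ℕ.* 4) ℤ.* + q)     ∎)
    where
    open ≡-Reasoning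
    square : ∀ a b → a * b * (a * b) ≡ a * a * (b * b)
    square = solve-∀ ℚ-ring
    shuffle : ∀ q a b → q ℕ.* a ℕ.* b ℕ.* 4 ≡ a ℕ.* b ℕ.* 4 ℕ.* q
    shuffle = ℕ-solve-∀
  q∣A² : + q ∣ℤ A ℤ.* A
  q∣A² = subst (+ q ∣ℤ_) (difference E A)
    (∣m∣n⇒∣m-n (divides (+ (q ℕ.^ t ℕ.* q ℕ.^ τ ℕ.* 4)) E²≡) (∣m⇒∣m*n (E ℤ.+ A) (lucasℤ-congruence t)))
    where
    difference : ∀ E A → E ℤ.* E ℤ.- (E ℤ.- A) ℤ.* (E ℤ.+ A) ≡ A ℤ.* A
    difference = ℤ-solve-∀
  q∣1 : q ∣ₙ 1
  q∣1 = coprime-cancel-^ coprime τ (subst (q ∣ₙ_) (sym (ℕP.*-identityʳ (p ℕ.^ τ)))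
          (coprime-cancel-^ coprime τ (subst (q ∣ₙ_) (trans (ℤP.abs-* A A) (cong₂ ℕ._*_ (abs-P^ τ) (abs-P^ τ))) (∣⇒∣ᵤ q∣A²))))

coprime-shift : ∀ {a b} → Coprime a b → ∀ s → Coprime (s ℕ.* b ℕ.+ a) b
coprime-shift c zero = c
coprime-shift {a} {b} c (suc s) = subst (λ m → Coprime m b) (sym (ℕP.+-assoc b (s ℕ.* b) a)) (coprime-+ (coprime-shift c s))

four-over-lowest-terms : ∀ k → k ≢ 0 → k ≢ 1 → k ≢ 2 → k ≢ 4 →
                         ∃ λ p → ∃ λ q → 4 ℕ.* q ≡ p ℕ.* k × 2 ≤ q × Coprime q p
four-over-lowest-terms k k≢0 k≢1 k≢2 k≢4 =
  by-residue (k ℕ./ 4) (k % 4) (m%n<n k 4) (trans (m≡m%n+[m/n]*n k 4) (ℕP.+-comm (k % 4) _))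
  where
  by-four : ∀ q → 4 ℕ.* q ≡ 1 ℕ.* (q ℕ.* 4 ℕ.+ 0)
  by-four = ℕ-solve-∀
  by-two : ∀ s → 4 ℕ.* (s ℕ.* 2 ℕ.+ 1) ≡ 2 ℕ.* (s ℕ.* 4 ℕ.+ 2)
  by-two = ℕ-solve-∀
  by-residue : ∀ t r → r < 4 → k ≡ t ℕ.* 4 ℕ.+ r → ∃ λ p → ∃ λ q → 4 ℕ.* q ≡ p ℕ.* k × 2 ≤ q × Coprime q p
  by-residue zero          0 _ k≡ = contradiction k≡ k≢0
  by-residue (suc zero)    0 _ k≡ = contradiction k≡ k≢4
  by-residue (suc (suc t)) 0 _ k≡ =
    1 , suc (suc t) , trans (by-four (suc (suc t))) (cong (1 ℕ.*_) (sym k≡)) , s≤s (s≤s z≤n) ,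
    Coprimality.sym (1-coprimeTo _)
  by-residue zero          1 _ k≡ = contradiction k≡ k≢1
  by-residue (suc t)       1 _ k≡ =
    4 , k , refl , subst (2 ≤_) (sym k≡) (s≤s (s≤s z≤n)) ,
    subst (λ m → Coprime m 4) (sym k≡) (coprime-shift (1-coprimeTo 4) (suc t))
  by-residue zero          2 _ k≡ = contradiction k≡ k≢2
  by-residue (suc t)       2 _ k≡ =
    2 , suc t ℕ.* 2 ℕ.+ 1 , trans (by-two (suc t)) (cong (2 ℕ.*_) (sym k≡)) , s≤s (s≤s z≤n) ,
    coprime-shift (1-coprimeTo 2) (suc t)
  by-residue t             3 _ k≡ =
    4 , k , refl , subst (2 ≤_) (sym k≡) (ℕP.≤-trans (s≤s (s≤s z≤n)) (ℕP.m≤n+m 3 (t ℕ.* 4))) ,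
    subst (λ m → Coprime m 4) (sym k≡) (coprime-shift (from-yes (coprime? 3 4)) t)
  by-residue t (suc (suc (suc (suc r)))) (s≤s (s≤s (s≤s (s≤s ())))) k≡

lowest-terms⇒lucas-parameter : ∀ {p q k′} → 4 ℕ.* q ≡ p ℕ.* suc k′ → ℕtoℚ q * - (ℕtoℚ 4 * recip (suc k′)) ≡ - ℕtoℚ p
lowest-terms⇒lucas-parameter {p} {q} {k′} 4q≡pk = begin
  ℕtoℚ q * - (ℕtoℚ 4 * r)          ≡⟨ regroup (ℕtoℚ q) r ⟩
  - (ℕtoℚ 4 * ℕtoℚ q * r)          ≡⟨ cong (λ z → - (z * r)) (sym (ℕtoℚ-* 4 q)) ⟩
  - (ℕtoℚ (4 ℕ.* q) * r)           ≡⟨ cong (λ z → - (ℕtoℚ z * r)) 4q≡pk ⟩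
  - (ℕtoℚ (p ℕ.* suc k′) * r)      ≡⟨ cong (λ z → - (z * r)) (ℕtoℚ-* p (suc k′)) ⟩
  - (ℕtoℚ p * K * r)               ≡⟨ cong -_ (ℚP.*-assoc (ℕtoℚ p) K r) ⟩
  - (ℕtoℚ p * (K * r))             ≡⟨ cong (λ z → - (ℕtoℚ p * z)) (trans (ℚP.*-comm K r) (recip-inverse k′)) ⟩
  - (ℕtoℚ p * 1ℚ)                  ≡⟨ cong -_ (ℚP.*-identityʳ (ℕtoℚ p)) ⟩
  - ℕtoℚ p                         ∎
  where
  open ≡-Reasoning
  K = ℕtoℚ (suc k′)
  r = recip (suc k′)
  regroup : ∀ q r → q * - (ℕtoℚ 4 * r) ≡ - (ℕtoℚ 4 * q * r)
  regroup = solve-∀ ℚ-ring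

==-refl : ∀ {n} (x : Fin n) → (x == x) ≡ true
==-refl x with x ≟ᶠ x
... | yes _   = refl
... | no x≢x = contradiction refl x≢x

==-≢ : ∀ {n} {x y : Fin n} → x ≢ y → (x == y) ≡ false
==-≢ {x = x} {y} x≢y with x ≟ᶠ y
... | yes x≡y = contradiction x≡y x≢y
... | no _    = refl

==-false⇒≢ : ∀ {n} {x y : Fin n} → (x == y) ≡ false → x ≢ y
==-false⇒≢ {x = x} x≠y refl = contradiction (trans (sym (==-refl x)) x≠y) λ ()

==⇒≡ : ∀ {n} {x y : Fin n} → (x == y) ≡ true → x ≡ y
==⇒≡ {x = x} {y} eq with x ≟ᶠ y
... | yes x≡y = x≡y

==-sym : ∀ {n} (x y : Fin n) → (x == y) ≡ (y == x)
==-sym x y with x ≟ᶠ y | y ≟ᶠ x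
... | yes _    | yes _    = refl
... | no _     | no _     = refl
... | yes refl | no x≢x  = contradiction refl x≢x
... | no x≢y   | yes refl = contradiction refl x≢y

b2q-∧ : ∀ a b → b2q (a ∧ b) ≡ b2q a * b2q b
b2q-∧ true  b = sym (ℚP.*-identityˡ (b2q b))
b2q-∧ false b = sym (ℚP.*-zeroˡ (b2q b))

∧-true : ∀ {a b} → a ∧ b ≡ true → a ≡ true × b ≡ true
∧-true {true} {true} _ = refl , refl

∨-pair-comm : ∀ a b → a ∨ (b ∨ false) ≡ b ∨ (a ∨ false)
∨-pair-comm true  true  = refl
∨-pair-comm true  false = refl
∨-pair-comm false b     = refl

not-∨-pairs : ∀ a b c d → not (a ∨ (b ∨ false)) ∧ not (c ∨ (d ∨ false)) ≡ not (a ∨ (b ∨ (c ∨ (d ∨ false))))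
not-∨-pairs true  b     c d = refl
not-∨-pairs false true  c d = refl
not-∨-pairs false false c d = refl

not-∨-false : ∀ {a b} → not (a ∨ b) ≡ true → a ≡ false × b ≡ false
not-∨-false {false} {false} _ = refl , refl

sumℚ-cong : ∀ {n} {f g : Fin n → ℚ} → (∀ i → f i ≡ g i) → sumℚ f ≡ sumℚ g
sumℚ-cong {zero}  f≗g = refl
sumℚ-cong {suc n} f≗g = cong₂ _+_ (f≗g zero) (sumℚ-cong (f≗g ∘ suc))

sumℚ-zero : ∀ {n} {f : Fin n → ℚ} → (∀ i → f i ≡ 0ℚ) → sumℚ f ≡ 0ℚ
sumℚ-zero {zero}  f≗0 = refl
sumℚ-zero {suc n} f≗0 = cong₂ _+_ (f≗0 zero) (sumℚ-zero (f≗0 ∘ suc))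

sumℚ-single : ∀ {n} {f : Fin n → ℚ} j → (∀ i → i ≢ j → f i ≡ 0ℚ) → sumℚ f ≡ f j
sumℚ-single {suc n} {f} zero    f≗0 =
  trans (cong (_+_ (f zero)) (sumℚ-zero (λ i → f≗0 (suc i) λ ()))) (ℚP.+-identityʳ (f zero))
sumℚ-single {suc n} {f} (suc j) f≗0 =
  trans (cong₂ _+_ (f≗0 zero λ ()) (sumℚ-single j (λ i i≢j → f≗0 (suc i) (i≢j ∘ suc-injective))))
        (ℚP.+-identityˡ (f (suc j)))

sumℚ-+ : ∀ {n} (f g : Fin n → ℚ) → sumℚ (λ i → f i + g i) ≡ sumℚ f + sumℚ g
sumℚ-+ {zero}  f g = refl
sumℚ-+ {suc n} f g = trans (cong (_+_ (f zero + g zero)) (sumℚ-+ (f ∘ suc) (g ∘ suc)))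
                           (interchange (f zero) (g zero) _ _)
  where
  interchange : ∀ a b c d → a + b + (c + d) ≡ a + c + (b + d)
  interchange = solve-∀ ℚ-ring

sumℚ-*ˡ : ∀ {n} c (f : Fin n → ℚ) → sumℚ (λ i → c * f i) ≡ c * sumℚ f
sumℚ-*ˡ {zero}  c f = sym (ℚP.*-zeroʳ c)
sumℚ-*ˡ {suc n} c f = trans (cong (_+_ (c * f zero)) (sumℚ-*ˡ c (f ∘ suc)))
                            (sym (ℚP.*-distribˡ-+ c (f zero) _))

sumℚ-δ : ∀ {n} j (f : Fin n → ℚ) → sumℚ (λ i → b2q (i == j) * f i) ≡ f j
sumℚ-δ j f = trans (sumℚ-single j (λ i i≢j → trans (cong (λ b → b2q b * f i) (==-≢ i≢j)) (ℚP.*-zeroˡ (f i))))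
                   (trans (cong (λ b → b2q b * f j) (==-refl j)) (ℚP.*-identityˡ (f j)))

sumℚ-linear : ∀ {n} s (f g : Fin n → ℚ) → sumℚ (λ i → s * f i - g i) ≡ s * sumℚ f - sumℚ g
sumℚ-linear {zero}  s f g = empty s
  where
  empty : ∀ s → 0ℚ ≡ s * 0ℚ - 0ℚ
  empty = solve-∀ ℚ-ring
sumℚ-linear {suc n} s f g = trans (cong (_+_ (s * f zero - g zero)) (sumℚ-linear s (f ∘ suc) (g ∘ suc)))
                                  (regroup s (f zero) (g zero) _ _)
  where
  regroup : ∀ s a b c d → s * a - b + (s * c - d) ≡ s * (a + c) - (b + d)
  regroup = solve-∀ ℚ-ring

sumℚ-three : ∀ {n} α β γ (f g h : Fin n → ℚ) →
             sumℚ (λ i → α * f i + β * g i + γ * h i) ≡ α * sumℚ f + β * sumℚ g + γ * sumℚ h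
sumℚ-three α β γ f g h = begin
  sumℚ (λ i → α * f i + β * g i + γ * h i)
    ≡⟨ sumℚ-+ (λ i → α * f i + β * g i) (λ i → γ * h i) ⟩
  sumℚ (λ i → α * f i + β * g i) + sumℚ (λ i → γ * h i)
    ≡⟨ cong (_+ sumℚ (λ i → γ * h i)) (sumℚ-+ (λ i → α * f i) (λ i → β * g i)) ⟩
  sumℚ (λ i → α * f i) + sumℚ (λ i → β * g i) + sumℚ (λ i → γ * h i)
    ≡⟨ cong₂ _+_ (cong₂ _+_ (sumℚ-*ˡ α f) (sumℚ-*ˡ β g)) (sumℚ-*ˡ γ h) ⟩
  α * sumℚ f + β * sumℚ g + γ * sumℚ h ∎
  where open ≡-Reasoning

count : ∀ {n} → (Fin n → Bool) → ℕ
count P = sumℕ (λ z → b2n (P z))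

sumℕ-cong : ∀ {n} {f g : Fin n → ℕ} → (∀ i → f i ≡ g i) → sumℕ f ≡ sumℕ g
sumℕ-cong {zero}  f≗g = refl
sumℕ-cong {suc n} f≗g = cong₂ ℕ._+_ (f≗g zero) (sumℕ-cong (f≗g ∘ suc))

sumℕ-+ : ∀ {n} (f g : Fin n → ℕ) → sumℕ (λ i → f i ℕ.+ g i) ≡ sumℕ f ℕ.+ sumℕ g
sumℕ-+ {zero}  f g = refl
sumℕ-+ {suc n} f g = trans (cong (f zero ℕ.+ g zero ℕ.+_) (sumℕ-+ (f ∘ suc) (g ∘ suc)))
                           (interchange (f zero) (g zero) _ _)
  where
  interchange : ∀ a b c d → a ℕ.+ b ℕ.+ (c ℕ.+ d) ≡ a ℕ.+ c ℕ.+ (b ℕ.+ d)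
  interchange = ℕ-solve-∀

sumℕ-mono : ∀ {n} {f g : Fin n → ℕ} → (∀ i → f i ≤ g i) → sumℕ f ≤ sumℕ g
sumℕ-mono {zero}  f≤g = z≤n
sumℕ-mono {suc n} f≤g = ℕP.+-mono-≤ (f≤g zero) (sumℕ-mono (f≤g ∘ suc))

b2n-∨ : ∀ a b → a ∧ b ≡ false → b2n (a ∨ b) ≡ b2n a ℕ.+ b2n b
b2n-∨ true  false _ = refl
b2n-∨ false b     _ = refl

count-∨ : ∀ {n} (P Q : Fin n → Bool) → (∀ z → P z ∧ Q z ≡ false) →
          count (λ z → P z ∨ Q z) ≡ count P ℕ.+ count Q
count-∨ P Q disjoint = trans (sumℕ-cong (λ z → b2n-∨ (P z) (Q z) (disjoint z))) (sumℕ-+ (b2n ∘ P) (b2n ∘ Q))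

count-true : ∀ {n} → count {n} (λ _ → true) ≡ n
count-true {zero}  = refl
count-true {suc n} = cong suc (count-true {n})

count-complement : ∀ {n} (P : Fin n → Bool) → count P ℕ.+ count (not ∘ P) ≡ n
count-complement P = trans (sym (count-∨ P (not ∘ P) (∧-inverseʳ ∘ P)))
                           (trans (sumℕ-cong (cong b2n ∘ ∨-inverseʳ ∘ P)) count-true)

count-false : ∀ {n} {P : Fin n → Bool} → (∀ z → P z ≡ false) → count P ≡ 0
count-false {zero}  P≗false = refl
count-false {suc n} P≗false rewrite P≗false zero = count-false (P≗false ∘ suc)

count-single : ∀ {n} {P : Fin n → Bool} j → P j ≡ true → (∀ z → z ≢ j → P z ≡ false) → count P ≡ 1
count-single {suc n} {P} zero Pj P≗false rewrite Pj = cong suc (count-false (λ z → P≗false (suc z) λ ()))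
count-single {suc n} {P} (suc j) Pj P≗false rewrite P≗false zero (λ ()) =
  count-single j Pj (λ z z≢j → P≗false (suc z) (z≢j ∘ suc-injective))

count-== : ∀ {n} (j : Fin n) → count (_== j) ≡ 1
count-== j = count-single j (==-refl j) (λ z → ==-≢)

count-mono : ∀ {n} {P Q : Fin n → Bool} → (∀ z → P z ≡ true → Q z ≡ true) → count P ≤ count Q
count-mono {P = P} {Q} P⇒Q = sumℕ-mono pointwise
  where
  pointwise : ∀ z → b2n (P z) ≤ b2n (Q z)
  pointwise z with P z in Pz
  ... | false = z≤n
  ... | true rewrite P⇒Q z Pz = ≤-refl
    where open ℕP using (≤-refl)

count-witness : ∀ {n} (P : Fin n → Bool) → 0 < count P → ∃ λ z → P z ≡ true
count-witness {suc n} P 0<count with P zero in P0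
... | true  = zero , P0
... | false = let z , Pz = count-witness (P ∘ suc) 0<count in suc z , Pz

count-pair : ∀ {n} {w z : Fin n} → w ≢ z → count (λ v → (v == w) ∨ (v == z)) ≡ 2
count-pair {w = w} {z} w≢z = trans (count-∨ (_== w) (_== z) disjoint) (cong₂ ℕ._+_ (count-== w) (count-== z))
  where
  disjoint : ∀ v → (v == w) ∧ (v == z) ≡ false
  disjoint v with v == w in v≡w
  ... | false = refl
  ... | true  = ==-≢ (λ v≡z → w≢z (trans (sym (==⇒≡ v≡w)) v≡z))

count-≥1 : ∀ {n} {P : Fin n → Bool} {z} → P z ≡ true → 1 ≤ count P
count-≥1 {P = P} {z} Pz = subst (_≤ count P) (count-== z)
  (count-mono {P = _== z} λ v v≡z → subst (λ u → P u ≡ true) (sym (==⇒≡ v≡z)) Pz)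

count-≥2 : ∀ {n} {P : Fin n → Bool} {w z} → w ≢ z → P w ≡ true → P z ≡ true → 2 ≤ count P
count-≥2 {P = P} {w} {z} w≢z Pw Pz = subst (_≤ count P) (count-pair w≢z) (count-mono both)
  where
  both : ∀ v → (v == w) ∨ (v == z) ≡ true → P v ≡ true
  both v eq with v == w in v≡w | v == z in v≡z
  ... | true  | _    = subst (λ u → P u ≡ true) (sym (==⇒≡ v≡w)) Pw
  ... | false | true = subst (λ u → P u ≡ true) (sym (==⇒≡ v≡z)) Pz

count-unique : ∀ {n} (P : Fin n → Bool) → count P ≡ 1 →
               ∃ λ z → P z ≡ true × (∀ w → P w ≡ true → w ≡ z)
count-unique P count≡1 with z , Pz ← count-witness P (ℕP.≤-reflexive (sym count≡1)) = z , Pz , unique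
  where
  unique : ∀ w → P w ≡ true → w ≡ z
  unique w Pw with w ≟ᶠ z
  ... | yes w≡z = w≡z
  ... | no w≢z  = contradiction (subst (2 ≤_) count≡1 (count-≥2 w≢z Pw Pz)) λ { (s≤s ()) }

any-==-false : ∀ {n} {z : Fin n} {vs} → All (z ≢_) vs → any (z ==_) vs ≡ false
any-==-false []              = refl
any-==-false (z≢v ∷ z≢vs) rewrite ==-≢ z≢v = any-==-false z≢vs

count-any : ∀ {n} {vs : List (Fin n)} → Unique vs → count (λ z → any (z ==_) vs) ≡ length vs
count-any {n} {vs = []} [] = count-false {n} (λ _ → refl)
count-any {vs = v ∷ vs} (v∉vs ∷ unique) =
  trans (count-∨ (_== v) (λ z → any (z ==_) vs) disjoint) (cong₂ ℕ._+_ (count-== v) (count-any unique))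
  where
  disjoint : ∀ z → (z == v) ∧ any (z ==_) vs ≡ false
  disjoint z with z == v in z≡v
  ... | false = refl
  ... | true rewrite ==⇒≡ z≡v = any-==-false v∉vs

count-none : ∀ {n} {vs : List (Fin n)} → Unique vs → count (λ z → not (any (z ==_) vs)) ℕ.+ length vs ≡ n
count-none {n} {vs} unique = begin
  count (not ∘ inVs) ℕ.+ length vs          ≡⟨ cong (count (not ∘ inVs) ℕ.+_) (count-any unique) ⟨
  count (not ∘ inVs) ℕ.+ count inVs         ≡⟨ ℕP.+-comm (count (not ∘ inVs)) (count inVs) ⟩
  count inVs ℕ.+ count (not ∘ inVs)         ≡⟨ count-complement inVs ⟩
  n                                         ∎
  where
  open ≡-Reasoning
  inVs : Fin n → Bool
  inVs z = any (z ==_) vs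

ℕtoℚ-count : ∀ {n} (P : Fin n → Bool) → ℕtoℚ (count P) ≡ sumℚ (λ z → b2q (P z))
ℕtoℚ-count {zero}  P = refl
ℕtoℚ-count {suc n} P = trans (ℕtoℚ-+ (b2n (P zero)) (count (P ∘ suc)))
                             (cong₂ _+_ (b2q-b2n (P zero)) (ℕtoℚ-count (P ∘ suc)))
  where
  b2q-b2n : ∀ b → ℕtoℚ (b2n b) ≡ b2q b
  b2q-b2n true  = refl
  b2q-b2n false = refl

module _ {n : ℕ} (G : Graph n) where

  adj⇒≢ : ∀ {a b} → adj G a b ≡ true → a ≢ b
  adj⇒≢ {a} ab refl = contradiction (trans (sym ab) (irrefl G a)) λ ()

  neighbour-exists : ∀ x → 0 < deg G x → ∃ λ v → adj G x v ≡ true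
  neighbour-exists x = count-witness (adj G x)

  unique-neighbour⇒deg≤1 : ∀ {x y} → (∀ z → adj G x z ≡ true → z ≡ y) → deg G x ≤ 1
  unique-neighbour⇒deg≤1 {x} {y} only-y = subst (deg G x ≤_) (count-== y)
    (count-mono (λ z xz → subst (λ w → (z == w) ≡ true) (only-y z xz) (==-refl z)))

  deg≤1⇒unique-neighbour : ∀ {x v w} → deg G x ≤ 1 → adj G x v ≡ true → adj G x w ≡ true → v ≡ w
  deg≤1⇒unique-neighbour {x} {v} {w} deg≤1 xv xw with v ≟ᶠ w
  ... | yes v≡w = v≡w
  ... | no v≢w  = contradiction (ℕP.≤-trans (count-≥2 v≢w xv xw) deg≤1) λ { (s≤s ()) }

  walk-1-regular : (∀ u → deg G u ≡ 1) → ∀ {x v z} → adj G x v ≡ true → Reach G x z → z ≡ x ⊎ z ≡ v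
  walk-1-regular deg≡1     xv here = inj₁ refl
  walk-1-regular deg≡1 {x} xv (step xy y⇝z)
    with refl ← deg≤1⇒unique-neighbour (ℕP.≤-reflexive (deg≡1 x)) xy xv =
    Sum.swap (walk-1-regular deg≡1 (trans (symm G _ x) xv) y⇝z)

  connected-1-regular⇒complete : (∀ u → deg G u ≡ 1) → Connected G → ∀ p q → p ≢ q → adj G p q ≡ true
  connected-1-regular⇒complete deg≡1 connected p q p≢q
    with v , pv ← neighbour-exists p (ℕP.≤-reflexive (sym (deg≡1 p)))
    with walk-1-regular deg≡1 pv (connected p q)
  ... | inj₁ q≡p = contradiction (sym q≡p) p≢q
  ... | inj₂ refl = pv

  common-self : ∀ x → common G x x ≡ deg G x
  common-self x = sumℕ-cong (λ z → cong b2n (∧-idem (adj G x z)))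

  edge : Fin n → Fin n → Fin 2 → Fin n
  edge a b zero       = a
  edge a b (suc zero) = b

  edge-clique : ∀ {a b} → adj G a b ≡ true → ∀ r s → r ≢ s → adj G (edge a b r) (edge a b s) ≡ true
  edge-clique ab zero       zero       r≢s = contradiction refl r≢s
  edge-clique ab zero       (suc zero) _   = ab
  edge-clique ab (suc zero) zero       _   = trans (symm G _ _) ab
  edge-clique ab (suc zero) (suc zero) r≢s = contradiction refl r≢s

  triangle : Fin n → Fin n → Fin n → Fin 3 → Fin n
  triangle a b c zero             = a
  triangle a b c (suc zero)       = b
  triangle a b c (suc (suc zero)) = c

  triangle-clique : ∀ {a b c} → adj G a b ≡ true → adj G a c ≡ true → adj G b c ≡ true →
                    ∀ r s → r ≢ s → adj G (triangle a b c r) (triangle a b c s) ≡ true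
  triangle-clique ab ac bc zero             zero             r≢s = contradiction refl r≢s
  triangle-clique ab ac bc zero             (suc zero)       _   = ab
  triangle-clique ab ac bc zero             (suc (suc zero)) _   = ac
  triangle-clique ab ac bc (suc zero)       zero             _   = trans (symm G _ _) ab
  triangle-clique ab ac bc (suc zero)       (suc zero)       r≢s = contradiction refl r≢s
  triangle-clique ab ac bc (suc zero)       (suc (suc zero)) _   = bc
  triangle-clique ab ac bc (suc (suc zero)) zero             _   = trans (symm G _ _) ac
  triangle-clique ab ac bc (suc (suc zero)) (suc zero)       _   = trans (symm G _ _) bc
  triangle-clique ab ac bc (suc (suc zero)) (suc (suc zero)) r≢s = contradiction refl r≢s

-- Cocktail party graphs

-- H is the complement of the perfect matching {u , mate u}.
record CocktailParty {m : ℕ} (H : Fin m → Fin m → Bool) : Set where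
  field
    mate     : Fin m → Fin m
    mate-≢   : ∀ u → mate u ≢ u
    adj-mate : ∀ u z → H u z ≡ not (any (z ==_) (u ∷ mate u ∷ []))

module _ {n : ℕ} (G : Graph n) where

  deg-of-mate : ∀ {u v} → v ≢ u → (∀ z → adj G u z ≡ not (any (z ==_) (u ∷ v ∷ []))) → deg G u ℕ.+ 2 ≡ n
  deg-of-mate v≢u adj≡ = trans (cong (ℕ._+ 2) (sumℕ-cong (cong b2n ∘ adj≡))) (count-none ((v≢u ∘ sym ∷ []) ∷ [] ∷ []))

  adj-of-unique-nonneighbour : ∀ {u v} → adj G u v ≡ false → (∀ z → z ≢ u → adj G u z ≡ false → z ≡ v) →
                               ∀ z → adj G u z ≡ not (any (z ==_) (u ∷ v ∷ []))
  adj-of-unique-nonneighbour {u} {v} uv only-v z with z ≟ᶠ u | z ≟ᶠ v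
  ... | yes refl | _        = irrefl G z
  ... | no z≢u   | yes refl = uv
  ... | no z≢u   | no z≢v   with adj G u z in uz
  ...   | true  = refl
  ...   | false = contradiction (only-v z z≢u uz) z≢v

  cocktailParty-from-degree : (∀ u → deg G u ℕ.+ 2 ≡ n) → CocktailParty (adj G)
  cocktailParty-from-degree deg+2≡n = record
    { mate     = λ u → proj₁ (nonneighbour u)
    ; mate-≢   = λ u → ==-false⇒≢ (proj₂ (not-∨-false (proj₁ (proj₂ (nonneighbour u)))))
    ; adj-mate = λ u → adj-of-unique-nonneighbour
                         (proj₁ (not-∨-false (proj₁ (proj₂ (nonneighbour u)))))
                         (λ z z≢u uz → proj₂ (proj₂ (nonneighbour u)) z (not-∨-intro uz (==-≢ z≢u)))
    }
    where
    not-∨-intro : ∀ {a b} → a ≡ false → b ≡ false → not (a ∨ b) ≡ true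
    not-∨-intro refl refl = refl
    adjacent-or-self : Fin n → Fin n → Bool
    adjacent-or-self u z = adj G u z ∨ (z == u)
    count-adj-or-self : ∀ u → count (adjacent-or-self u) ≡ deg G u ℕ.+ 1
    count-adj-or-self u = trans (count-∨ (adj G u) (_== u) disjoint) (cong (deg G u ℕ.+_) (count-== u))
      where
      disjoint : ∀ z → adj G u z ∧ (z == u) ≡ false
      disjoint z with z == u in z≡u
      ... | false = ∧-zeroʳ (adj G u z)
      ... | true rewrite ==⇒≡ z≡u = cong (_∧ true) (irrefl G u)
    count-nonneighbours : ∀ u → count (not ∘ adjacent-or-self u) ≡ 1
    count-nonneighbours u = ℕP.+-cancelˡ-≡ (deg G u ℕ.+ 1) _ _ (begin
      deg G u ℕ.+ 1 ℕ.+ count (not ∘ adjacent-or-self u)    ≡⟨ cong (ℕ._+ count (not ∘ adjacent-or-self u)) (count-adj-or-self u) ⟨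
      count (adjacent-or-self u) ℕ.+ count (not ∘ adjacent-or-self u)   ≡⟨ count-complement (adjacent-or-self u) ⟩
      n                                                      ≡⟨ deg+2≡n u ⟨
      deg G u ℕ.+ 2                                          ≡⟨ ℕP.+-assoc (deg G u) 1 1 ⟨
      deg G u ℕ.+ 1 ℕ.+ 1                                    ∎)
      where open ≡-Reasoning
    nonneighbour : ∀ u → ∃ λ v → not (adjacent-or-self u v) ≡ true × (∀ z → not (adjacent-or-self u z) ≡ true → z ≡ v)
    nonneighbour u = count-unique (not ∘ adjacent-or-self u) (count-nonneighbours u)

module CocktailPartyGraph {n : ℕ} (G : Graph n) (C : CocktailParty (adj G)) where
  open CocktailParty C public

  mate-nonadjacent : ∀ u → adj G u (mate u) ≡ false
  mate-nonadjacent u rewrite adj-mate u (mate u) | ==-≢ (mate-≢ u) | ==-refl (mate u) = refl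

  nonadjacent⇒mate : ∀ {u z} → z ≢ u → adj G u z ≡ false → z ≡ mate u
  nonadjacent⇒mate {u} {z} z≢u uz with z == mate u in z≡mate | trans (sym (adj-mate u z)) uz
  ... | true  | _ = ==⇒≡ z≡mate
  ... | false | not≡false rewrite ==-≢ z≢u = contradiction not≡false λ ()

  mate-involutive : ∀ u → mate (mate u) ≡ u
  mate-involutive u = sym (nonadjacent⇒mate (mate-≢ u ∘ sym) (trans (symm G (mate u) u) (mate-nonadjacent u)))

  adj-mateˡ : ∀ a b → adj G (mate a) b ≡ adj G a b
  adj-mateˡ a b rewrite adj-mate (mate a) b | adj-mate a b | mate-involutive a = cong not (∨-pair-comm (b == mate a) (b == a))

  adj-mateʳ : ∀ a b → adj G a (mate b) ≡ adj G a b
  adj-mateʳ a b = trans (symm G a (mate b)) (trans (adj-mateˡ b a) (symm G b a))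

  deg+2 : ∀ u → deg G u ℕ.+ 2 ≡ n
  deg+2 u = deg-of-mate G (mate-≢ u) (adj-mate u)

  common-mate : ∀ u → common G u (mate u) ≡ deg G u
  common-mate u = sumℕ-cong (λ z → cong b2n (trans (cong (adj G u z ∧_) (adj-mateˡ u z)) (∧-idem (adj G u z))))

  common-adjacent : ∀ {u v} → adj G u v ≡ true → common G u v ℕ.+ 4 ≡ n
  common-adjacent {u} {v} uv = trans (cong (ℕ._+ 4) (sumℕ-cong (cong b2n ∘ adj∧adj))) (count-none distinct)
    where
    adj∧adj : ∀ z → adj G u z ∧ adj G v z ≡ not (any (z ==_) (u ∷ mate u ∷ v ∷ mate v ∷ []))
    adj∧adj z rewrite adj-mate u z | adj-mate v z = not-∨-pairs (z == u) (z == mate u) (z == v) (z == mate v)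
    distinct : Unique (u ∷ mate u ∷ v ∷ mate v ∷ [])
    distinct = (mate-≢ u ∘ sym ∷ adj⇒≢ G uv ∷ adj⇒≢ G (trans (adj-mateʳ u v) uv) ∷ [])
             ∷ (adj⇒≢ G (trans (adj-mateˡ u v) uv) ∷ adj⇒≢ G (trans (adj-mateˡ u (mate v)) (trans (adj-mateʳ u v) uv)) ∷ [])
             ∷ (mate-≢ v ∘ sym ∷ [])
             ∷ []
             ∷ []

  common-nonadjacent : ∀ {u v} → u ≢ v → adj G u v ≡ false → common G u v ≡ deg G u
  common-nonadjacent {u} u≢v uv rewrite nonadjacent⇒mate (u≢v ∘ sym) uv = common-mate u

  common-adjacent+2 : ∀ {u v} → adj G u v ≡ true → common G u v ℕ.+ 2 ≡ deg G u
  common-adjacent+2 {u} {v} uv = ℕP.+-cancelʳ-≡ 2 (common G u v ℕ.+ 2) (deg G u)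
    (trans (ℕP.+-assoc (common G u v) 2 2) (trans (common-adjacent uv) (sym (deg+2 u))))

module _ {n m : ℕ} (f : Fin n ↔ Fin m) where
  open Inverse f

  to-== : ∀ z w → (to z == w) ≡ (z == from w)
  to-== z w with z ≟ᶠ from w
  ... | yes refl = trans (cong (_== w) (strictlyInverseˡ w)) (==-refl w)
  ... | no z≢    = ==-≢ (λ to-z≡w → z≢ (trans (sym (strictlyInverseʳ z)) (cong from to-z≡w)))

  ↔-size : n ≡ m
  ↔-size = ℕP.≤-antisym (injective⇒≤ to-injective) (injective⇒≤ from-injective)
    where
    to-injective : ∀ {a b} → to a ≡ to b → a ≡ b
    to-injective {a} {b} eq = trans (sym (strictlyInverseʳ a)) (trans (cong from eq) (strictlyInverseʳ b))
    from-injective : ∀ {a b} → from a ≡ from b → a ≡ b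
    from-injective {a} {b} eq = trans (sym (strictlyInverseˡ a)) (trans (cong to eq) (strictlyInverseˡ b))

cocktailParty-transport : ∀ {n m} (G : Graph n) {H : Fin m → Fin m → Bool} →
                          IsomorphicTo G H → CocktailParty H → CocktailParty (adj G)
cocktailParty-transport G {H} (f , adj≡H) C = record
  { mate     = λ u → from (mate (to u))
  ; mate-≢   = λ u mate≡u → mate-≢ (to u) (trans (sym (strictlyInverseˡ (mate (to u)))) (cong to mate≡u))
  ; adj-mate = λ u z → begin
      adj G u z                                                  ≡⟨ adj≡H u z ⟩
      H (to u) (to z)                                            ≡⟨ adj-mate (to u) (to z) ⟩
      not ((to z == to u) ∨ ((to z == mate (to u)) ∨ false))     ≡⟨ cong₂ (λ a b → not (a ∨ (b ∨ false)))
                                                                          (to-== f z (to u)) (to-== f z (mate (to u))) ⟩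
      not ((z == from (to u)) ∨ ((z == from (mate (to u))) ∨ false))
                                                                 ≡⟨ cong (λ v → not ((z == v) ∨ ((z == from (mate (to u))) ∨ false)))
                                                                         (strictlyInverseʳ u) ⟩
      not ((z == u) ∨ ((z == from (mate (to u))) ∨ false))       ∎
  }
  where
  open Inverse f
  open CocktailParty C
  open ≡-Reasoning

injective⇒surjective : ∀ {m n} (e : Fin m → Fin n) → (∀ {i j} → e i ≡ e j → i ≡ j) → m ≡ n → ∀ z → ∃ λ i → e i ≡ z
injective⇒surjective {m} e e-injective refl z with any? (λ i → e i ≟ᶠ z)
... | yes hit = hit
... | no miss = contradiction (injective⇒≤ extended-injective) ℕP.1+n≰n
  where
  extended : Fin (suc m) → Fin m
  extended zero    = z
  extended (suc i) = e i
  extended-injective : ∀ {i j} → extended i ≡ extended j → i ≡ j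
  extended-injective {zero}  {zero}  _  = refl
  extended-injective {zero}  {suc j} eq = contradiction (j , sym eq) miss
  extended-injective {suc i} {zero}  eq = contradiction (i , eq) miss
  extended-injective {suc i} {suc j} eq = cong suc (e-injective eq)

iso-from-embedding : ∀ {m n} (G : Graph n) {H : Fin m → Fin m → Bool} (e : Fin m → Fin n) → m ≡ n →
                     (∀ {i j} → e i ≡ e j → i ≡ j) → (∀ i j → adj G (e i) (e j) ≡ H i j) → IsomorphicTo G H
iso-from-embedding {m} {n} G {H} e m≡n e-injective adj≡H = mk↔ₛ′ preimage e preimage-e e-preimage , adj-preimage
  where
  preimage : Fin n → Fin m
  preimage z = proj₁ (injective⇒surjective e e-injective m≡n z)
  e-preimage : ∀ z → e (preimage z) ≡ z
  e-preimage z = proj₂ (injective⇒surjective e e-injective m≡n z)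
  preimage-e : ∀ i → preimage (e i) ≡ i
  preimage-e i = e-injective (e-preimage (e i))
  adj-preimage : ∀ x y → adj G x y ≡ H (preimage x) (preimage y)
  adj-preimage x y = trans (cong₂ (adj G) (sym (e-preimage x)) (sym (e-preimage y))) (adj≡H (preimage x) (preimage y))

module CocktailPartyClique {n : ℕ} (G : Graph n) (C : CocktailParty (adj G))
                           {p : ℕ} (c : Fin p → Fin n) (clique : ∀ r s → r ≢ s → adj G (c r) (c s) ≡ true) where
  open CocktailPartyGraph G C

  embed : Fin p ⊎ Fin p → Fin n
  embed = [ c , mate ∘ c ]′

  clique-adj : ∀ r s → adj G (c r) (c s) ≡ not (r == s)
  clique-adj r s with r ≟ᶠ s
  ... | yes refl = irrefl G (c r)
  ... | no r≢s   = clique r s r≢s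

  embed-adj : ∀ s t → adj G (embed s) (embed t) ≡ not (reduce s == reduce t)
  embed-adj (inj₁ r) (inj₁ s) = clique-adj r s
  embed-adj (inj₁ r) (inj₂ s) = trans (adj-mateʳ (c r) (c s)) (clique-adj r s)
  embed-adj (inj₂ r) (inj₁ s) = trans (adj-mateˡ (c r) (c s)) (clique-adj r s)
  embed-adj (inj₂ r) (inj₂ s) = trans (adj-mateˡ (c r) (mate (c s))) (trans (adj-mateʳ (c r) (c s)) (clique-adj r s))

  embed-injective : ∀ {s t} → embed s ≡ embed t → s ≡ t
  embed-injective {s} {t} eq
    with ==⇒≡ (not-injective (trans (sym (embed-adj s t)) (trans (cong (adj G (embed s)) (sym eq)) (irrefl G (embed s)))))
  embed-injective {inj₁ r} {inj₁ s} eq | r≡s = cong inj₁ r≡s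
  embed-injective {inj₂ r} {inj₂ s} eq | r≡s = cong inj₂ r≡s
  embed-injective {inj₁ r} {inj₂ s} eq | refl = contradiction (sym eq) (mate-≢ (c r))
  embed-injective {inj₂ r} {inj₁ s} eq | refl = contradiction eq (mate-≢ (c r))

  complete-multipartite : n ≡ p ℕ.+ p → {H : Fin (p ℕ.+ p) → Fin (p ℕ.+ p) → Bool} →
                          (∀ i j → H i j ≡ not (reduce (splitAt p i) == reduce (splitAt p j))) → IsomorphicTo G H
  complete-multipartite n≡p+p H≡ = iso-from-embedding G (embed ∘ splitAt p) (sym n≡p+p)
    (λ {i} {j} eq → trans (sym (join-splitAt p p i))
                          (trans (cong (join p p) (embed-injective {splitAt p i} {splitAt p j} eq)) (join-splitAt p p j)))
    (λ i j → trans (embed-adj (splitAt p i) (splitAt p j)) (sym (H≡ i j)))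

opposite : ∀ {p} → Fin (p ℕ.+ p) → Fin (p ℕ.+ p)
opposite {p} i = join p p (Sum.swap (splitAt p i))

K22-cocktailParty : CocktailParty K22
K22-cocktailParty = record
  { mate     = opposite {2}
  ; mate-≢   = from-yes (all? λ u → ¬? (opposite {2} u ≟ᶠ u))
  ; adj-mate = from-yes (all? λ u → all? λ z → K22 u z Bool.≟ not (any (z ==_) (u ∷ opposite {2} u ∷ [])))
  }

K222-cocktailParty : CocktailParty K222
K222-cocktailParty = record
  { mate     = opposite {3}
  ; mate-≢   = from-yes (all? λ u → ¬? (opposite {3} u ≟ᶠ u))
  ; adj-mate = from-yes (all? λ u → all? λ z → K222 u z Bool.≟ not (any (z ==_) (u ∷ opposite {3} u ∷ [])))
  }

-- reduce (splitAt p i) is i mod p, the part of i in the complete multipartite graph.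
K22-parts : ∀ i j → K22 i j ≡ not (reduce (splitAt 2 i) == reduce (splitAt 2 j))
K22-parts = from-yes (all? λ i → all? λ j → K22 i j Bool.≟ not (reduce (splitAt 2 i) == reduce (splitAt 2 j)))

K222-parts : ∀ i j → K222 i j ≡ not (reduce (splitAt 3 i) == reduce (splitAt 3 j))
K222-parts = from-yes (all? λ i → all? λ j → K222 i j Bool.≟ not (reduce (splitAt 3 i) == reduce (splitAt 3 j)))

-- The Grover walk on arc vectors of the form F (t a) + H (o a)

module GroverWalk {n : ℕ} (G : Graph n) where

  arcValue : (Arc G → ℚ) → Fin n → Fin n → ℚ
  arcValue F u w = arcTerm G (adj G u w) (λ p → F ((u , w) , p))

  inflow : (Arc G → ℚ) → Fin n → ℚ
  inflow F w = sumℚ (λ u → arcValue F u w)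

  arcTerm-cong : ∀ b {f f′ : b ≡ true → ℚ} → (∀ p → f p ≡ f′ p) → arcTerm G b f ≡ arcTerm G b f′
  arcTerm-cong true  f≗f′ = f≗f′ refl
  arcTerm-cong false f≗f′ = refl

  arcTerm-const : ∀ b {f : b ≡ true → ℚ} h → (∀ p → f p ≡ h) → arcTerm G b f ≡ b2q b * h
  arcTerm-const true  h f≡h = trans (f≡h refl) (sym (ℚP.*-identityˡ h))
  arcTerm-const false h f≡h = sym (ℚP.*-zeroˡ h)

  arcTerm-linear : ∀ b s (f g : b ≡ true → ℚ) → arcTerm G b (λ p → s * f p - g p) ≡ s * arcTerm G b f - arcTerm G b g
  arcTerm-linear true  s f g = refl
  arcTerm-linear false s f g = empty s
    where
    empty : ∀ s → 0ℚ ≡ s * 0ℚ - 0ℚ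
    empty = solve-∀ ℚ-ring

  arcValue-arc : ∀ F a → arcValue F (o G a) (t G a) ≡ F a
  arcValue-arc F ((u , w) , p) = arcTerm-at p
    where
    arcTerm-at : ∀ {b} (q : b ≡ true) {f : b ≡ true → ℚ} → arcTerm G b f ≡ f q
    arcTerm-at refl = refl

  sumArc-cong : ∀ {F F′ : Arc G → ℚ} → (∀ a → F a ≡ F′ a) → sumArc G F ≡ sumArc G F′
  sumArc-cong F≗F′ = sumℚ-cong λ u → sumℚ-cong λ w → arcTerm-cong (adj G u w) λ p → F≗F′ ((u , w) , p)

  sumArc-linear : ∀ s (F F′ : Arc G → ℚ) → sumArc G (λ a → s * F a - F′ a) ≡ s * sumArc G F - sumArc G F′
  sumArc-linear s F F′ = begin
    sumArc G (λ a → s * F a - F′ a)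
      ≡⟨ sumℚ-cong (λ u → sumℚ-cong λ w → arcTerm-linear (adj G u w) s _ _) ⟩
    sumℚ (λ u → sumℚ (λ w → s * arcValue F u w - arcValue F′ u w))
      ≡⟨ sumℚ-cong (λ u → sumℚ-linear s (arcValue F u) (arcValue F′ u)) ⟩
    sumℚ (λ u → s * sumℚ (arcValue F u) - sumℚ (arcValue F′ u))
      ≡⟨ sumℚ-linear s (sumℚ ∘ arcValue F) (sumℚ ∘ arcValue F′) ⟩
    s * sumArc G F - sumArc G F′ ∎
    where open ≡-Reasoning

  arcTerm-*ˡ : ∀ b s (f : b ≡ true → ℚ) → arcTerm G b (λ p → s * f p) ≡ s * arcTerm G b f
  arcTerm-*ˡ true  s f = refl
  arcTerm-*ˡ false s f = sym (ℚP.*-zeroʳ s)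

  sumArc-at : ∀ x y F → sumArc G (λ b → b2q ((o G b == x) ∧ (t G b == y)) * F b) ≡ arcValue F x y
  sumArc-at x y F = begin
    sumℚ (λ u → sumℚ (λ w → arcTerm G (adj G u w) (λ p → b2q ((u == x) ∧ (w == y)) * F ((u , w) , p))))
      ≡⟨ sumℚ-cong (λ u → sumℚ-cong λ w → trans (arcTerm-*ˡ (adj G u w) (b2q ((u == x) ∧ (w == y))) λ p → F ((u , w) , p))
                                                 (δ-split (u == x) (w == y) (arcValue F u w))) ⟩
    sumℚ (λ u → sumℚ (λ w → b2q (u == x) * (b2q (w == y) * arcValue F u w)))
      ≡⟨ sumℚ-cong (λ u → trans (sumℚ-*ˡ (b2q (u == x)) (λ w → b2q (w == y) * arcValue F u w))
                                  (cong (b2q (u == x) *_) (sumℚ-δ y (arcValue F u)))) ⟩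
    sumℚ (λ u → b2q (u == x) * arcValue F u y)
      ≡⟨ sumℚ-δ x (λ u → arcValue F u y) ⟩
    arcValue F x y ∎
    where
    open ≡-Reasoning
    δ-split : ∀ a b q → b2q (a ∧ b) * q ≡ b2q a * (b2q b * q)
    δ-split a b q = trans (cong (_* q) (b2q-∧ a b)) (ℚP.*-assoc (b2q a) (b2q b) q)

  sumArc-into : ∀ w F → sumArc G (λ b → b2q (t G b == w) * F b) ≡ inflow F w
  sumArc-into w F = sumℚ-cong λ u →
    trans (sumℚ-cong λ w′ → arcTerm-*ˡ (adj G u w′) (b2q (w′ == w)) λ p → F ((u , w′) , p)) (sumℚ-δ w (arcValue F u))

  Rᴬ-action : ∀ a F → sumArc G (λ b → Rᴬ G a b * F b) ≡ F (inv G a)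
  Rᴬ-action a F = begin
    sumArc G (λ b → Rᴬ G a b * F b)
      ≡⟨ sumArc-cong (λ b → cong (λ β → b2q β * F b) (reorder b)) ⟩
    sumArc G (λ b → b2q ((o G b == t G a) ∧ (t G b == o G a)) * F b)        ≡⟨ sumArc-at (t G a) (o G a) F ⟩
    arcValue F (t G a) (o G a)                                                  ≡⟨ arcValue-arc F (inv G a) ⟩
    F (inv G a)                                                             ∎
    where
    open ≡-Reasoning
    reorder : ∀ b → (o G a == t G b) ∧ (t G a == o G b) ≡ (o G b == t G a) ∧ (t G b == o G a)
    reorder b = trans (∧-comm (o G a == t G b) _) (cong₂ _∧_ (==-sym (t G a) (o G b)) (==-sym (o G a) (t G b)))

  Iᴬ-action : ∀ a F → sumArc G (λ b → Iᴬ G a b * F b) ≡ F a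
  Iᴬ-action a F = begin
    sumArc G (λ b → Iᴬ G a b * F b)
      ≡⟨ sumArc-cong (λ b → cong (λ β → b2q β * F b) (flip b)) ⟩
    sumArc G (λ b → b2q ((o G b == o G a) ∧ (t G b == t G a)) * F b)        ≡⟨ sumArc-at (o G a) (t G a) F ⟩
    arcValue F (o G a) (t G a)                                                  ≡⟨ arcValue-arc F a ⟩
    F a                                                                     ∎
    where
    open ≡-Reasoning
    flip : ∀ b → (o G a == o G b) ∧ (t G a == t G b) ≡ (o G b == o G a) ∧ (t G b == t G a)
    flip b = cong₂ _∧_ (==-sym (o G a) (o G b)) (==-sym (t G a) (t G b))

  U-action : ∀ v a → _·ᵛ_ G (Uᴬ G) v a ≡ ℕtoℚ 2 * recip (deg G (o G a)) * inflow v (o G a) - v (inv G a)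
  U-action v a = begin
    sumArc G (λ c → Uᴬ G a c * v c)
      ≡⟨ sumArc-cong (λ c → trans (cong (_* v c) (Rᴬ-action a (λ b → M b c))) (expand c)) ⟩
    sumArc G (λ c → s * (b2q (t G c == o G a) * v c) - Iᴬ G (inv G a) c * v c)
      ≡⟨ sumArc-linear s _ _ ⟩
    s * sumArc G (λ c → b2q (t G c == o G a) * v c) - sumArc G (λ c → Iᴬ G (inv G a) c * v c)
      ≡⟨ cong₂ (λ x y → s * x - y) (sumArc-into (o G a) v) (Iᴬ-action (inv G a) v) ⟩
    s * inflow v (o G a) - v (inv G a) ∎
    where
    open ≡-Reasoning
    s = ℕtoℚ 2 * recip (deg G (o G a))
    M : Arc G → Arc G → ℚ
    M b c = ℕtoℚ 2 * dd G b c - Iᴬ G b c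
    distribute : ∀ β r ι x → (ℕtoℚ 2 * (β * r) - ι) * x ≡ ℕtoℚ 2 * r * (β * x) - ι * x
    distribute = solve-∀ ℚ-ring
    expand : ∀ c → M (inv G a) c * v c ≡ s * (b2q (t G c == o G a) * v c) - Iᴬ G (inv G a) c * v c
    expand c = trans (distribute (b2q (o G a == t G c)) _ _ (v c))
                     (cong (λ β → s * (b2q β * v c) - Iᴬ G (inv G a) c * v c) (==-sym (o G a) (t G c)))

  A : (Fin n → ℚ) → Fin n → ℚ
  A g w = sumℚ (λ u → b2q (adj G w u) * g u)

  A-zero : ∀ w → A (λ _ → 0ℚ) w ≡ 0ℚ
  A-zero w = sumℚ-zero (λ u → ℚP.*-zeroʳ (b2q (adj G w u)))

  record Split (v : Arc G → ℚ) (f g : Fin n → ℚ) : Set where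
    constructor split
    field at : ∀ c → v c ≡ f (t G c) + g (o G c)
  open Split

  split-cong : ∀ {v f g f′ g′} → Split v f g → (∀ w → f w ≡ f′ w) → (∀ w → g w ≡ g′ w) → Split v f′ g′
  split-cong v≡ f≗f′ g≗g′ = split λ c → trans (at v≡ c) (cong₂ _+_ (f≗f′ _) (g≗g′ _))

  χ-split : ∀ x → Split (χ G x) (λ w → b2q (w == x)) (λ _ → 0ℚ)
  χ-split x = split λ c → sym (ℚP.+-identityʳ (χ G x c))

  inflow-split : ∀ {v f g} → Split v f g → ∀ w → inflow v w ≡ ℕtoℚ (deg G w) * f w + A g w
  inflow-split {v} {f} {g} v≡ w = begin
    sumℚ (λ u → arcValue v u w)
      ≡⟨ sumℚ-cong (λ u → arcTerm-const (adj G u w) (f w + g u) (λ p → at v≡ ((u , w) , p))) ⟩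
    sumℚ (λ u → b2q (adj G u w) * (f w + g u))
      ≡⟨ sumℚ-cong (λ u → trans (cong (λ β → b2q β * (f w + g u)) (symm G u w)) (distribute (b2q (adj G w u)) (f w) (g u))) ⟩
    sumℚ (λ u → f w * b2q (adj G w u) + b2q (adj G w u) * g u)
      ≡⟨ sumℚ-+ (λ u → f w * b2q (adj G w u)) (λ u → b2q (adj G w u) * g u) ⟩
    sumℚ (λ u → f w * b2q (adj G w u)) + A g w
      ≡⟨ cong (_+ A g w) (trans (sumℚ-*ˡ (f w) (λ u → b2q (adj G w u))) (cong (f w *_) (sym (ℕtoℚ-count (adj G w))))) ⟩
    f w * ℕtoℚ (deg G w) + A g w
      ≡⟨ cong (_+ A g w) (ℚP.*-comm (f w) (ℕtoℚ (deg G w))) ⟩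
    ℕtoℚ (deg G w) * f w + A g w ∎
    where
    open ≡-Reasoning
    distribute : ∀ β x y → β * (x + y) ≡ x * β + β * y
    distribute = solve-∀ ℚ-ring

  module Regular (k′ : ℕ) (regular : ∀ x → deg G x ≡ suc k′) where

    K r : ℚ
    K = ℕtoℚ (suc k′)
    r = recip (suc k′)

    U-split : ∀ {v f g} → Split v f g → Split (_·ᵛ_ G (Uᴬ G) v) (λ w → - g w) (λ w → f w + ℕtoℚ 2 * r * A g w)
    U-split {v} {f} {g} v≡ = split λ a → begin
      _·ᵛ_ G (Uᴬ G) v a                                           ≡⟨ U-action v a ⟩
      ℕtoℚ 2 * recip (deg G (o G a)) * inflow v (o G a) - v (inv G a)
        ≡⟨ cong₂ (λ d x → ℕtoℚ 2 * recip d * x - v (inv G a)) (regular (o G a)) (inflow-split v≡ (o G a)) ⟩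
      ℕtoℚ 2 * r * (ℕtoℚ (deg G (o G a)) * f (o G a) + A g (o G a)) - v (inv G a)
        ≡⟨ cong₂ (λ d x → ℕtoℚ 2 * r * (ℕtoℚ d * f (o G a) + A g (o G a)) - x) (regular (o G a)) (at v≡ (inv G a)) ⟩
      ℕtoℚ 2 * r * (K * f (o G a) + A g (o G a)) - (f (o G a) + g (t G a))
        ≡⟨ simplify r K (f (o G a)) (A g (o G a)) (g (t G a)) (recip-inverse k′) ⟩
      - g (t G a) + (f (o G a) + ℕtoℚ 2 * r * A g (o G a)) ∎
      where
      open ≡-Reasoning
      simplify : ∀ r K x y z → r * K ≡ 1ℚ → ℕtoℚ 2 * r * (K * x + y) - (x + z) ≡ - z + (x + ℕtoℚ 2 * r * y)
      simplify r K x y z rK≡1 = begin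
        ℕtoℚ 2 * r * (K * x + y) - (x + z)                      ≡⟨ regroup r K x y z ⟩
        ℕtoℚ 2 * (r * K) * x - x + (- z + ℕtoℚ 2 * r * y)
          ≡⟨ cong (λ q → ℕtoℚ 2 * q * x - x + (- z + ℕtoℚ 2 * r * y)) rK≡1 ⟩
        ℕtoℚ 2 * 1ℚ * x - x + (- z + ℕtoℚ 2 * r * y)          ≡⟨ cancel r x y z ⟩
        - z + (x + ℕtoℚ 2 * r * y)                             ∎
        where
        regroup : ∀ r K x y z → ℕtoℚ 2 * r * (K * x + y) - (x + z) ≡ ℕtoℚ 2 * (r * K) * x - x + (- z + ℕtoℚ 2 * r * y)
        regroup = solve-∀ ℚ-ring
        cancel : ∀ r x y z → ℕtoℚ 2 * 1ℚ * x - x + (- z + ℕtoℚ 2 * r * y) ≡ - z + (x + ℕtoℚ 2 * r * y)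
        cancel = solve-∀ ℚ-ring

    split-target : ∀ {v f g} s y → Split v f g → (∀ c → v c ≡ s * χ G y c) → ∀ w → K * f w + A g w ≡ K * (s * b2q (w == y))
    split-target {v} {f} {g} s y v≡ v≡sχ w = begin
      K * f w + A g w                                                ≡⟨ cong (λ d → ℕtoℚ d * f w + A g w) (regular w) ⟨
      ℕtoℚ (deg G w) * f w + A g w                                   ≡⟨ inflow-split v≡ w ⟨
      inflow v w                                                     ≡⟨ inflow-split target-split w ⟩
      ℕtoℚ (deg G w) * (s * b2q (w == y)) + A (λ _ → 0ℚ) w
        ≡⟨ cong₂ (λ d a → ℕtoℚ d * (s * b2q (w == y)) + a) (regular w) (A-zero w) ⟩
      K * (s * b2q (w == y)) + 0ℚ                                    ≡⟨ ℚP.+-identityʳ _ ⟩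
      K * (s * b2q (w == y))                                         ∎
      where
      open ≡-Reasoning
      target-split : Split v (λ w → s * b2q (w == y)) (λ _ → 0ℚ)
      target-split = split λ c → trans (v≡sχ c) (sym (ℚP.+-identityʳ _))

record CellVector : Set where
  constructor ⟨_,_,_⟩
  field
    self near far : ℚ
open CellVector

infixl 6 _+ᶜ_
infixl 7 _·ᶜ_

_+ᶜ_ : CellVector → CellVector → CellVector
⟨ a , b , c ⟩ +ᶜ ⟨ a′ , b′ , c′ ⟩ = ⟨ a + a′ , b + b′ , c + c′ ⟩

_·ᶜ_ : ℚ → CellVector → CellVector
s ·ᶜ ⟨ a , b , c ⟩ = ⟨ s * a , s * b , s * c ⟩

-ᶜ_ : CellVector → CellVector
-ᶜ ⟨ a , b , c ⟩ = ⟨ - a , - b , - c ⟩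

-- The quotient matrix of the partition {x}, N(x), V ∖ ({x} ∪ N(x)) of an SRG with parameters (k, l, m).
cellA : (k l m : ℕ) → CellVector → CellVector
cellA k l m ⟨ a , b , c ⟩ = ⟨ K * b , a + L * b + (K - 1ℚ - L) * c , M * b + (K - M) * c ⟩
  where
  K = ℕtoℚ k
  L = ℕtoℚ l
  M = ℕtoℚ m

-- The cell values of F and H in U^τ χ_x (a) = F (t a) + H (o a); the step mirrors U-split.
orbit : (k l m : ℕ) → ℕ → CellVector × CellVector
orbit k l m zero    = ⟨ 1ℚ , 0ℚ , 0ℚ ⟩ , ⟨ 0ℚ , 0ℚ , 0ℚ ⟩
orbit k l m (suc τ) = -ᶜ H , F +ᶜ (ℕtoℚ 2 * recip k) ·ᶜ cellA k l m H
  where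
  F = proj₁ (orbit k l m τ)
  H = proj₂ (orbit k l m τ)

pick : Bool → Bool → CellVector → ℚ
pick true  _     T = self T
pick false true  T = near T
pick false false T = far T

pick-neg : ∀ p q T → pick p q (-ᶜ T) ≡ - pick p q T
pick-neg true  _     T = refl
pick-neg false true  T = refl
pick-neg false false T = refl

pick-+· : ∀ p q F s H → pick p q (F +ᶜ s ·ᶜ H) ≡ pick p q F + s * pick p q H
pick-+· true  _     F s H = refl
pick-+· false true  F s H = refl
pick-+· false false F s H = refl

pick-unit : ∀ p q → pick p q ⟨ 1ℚ , 0ℚ , 0ℚ ⟩ ≡ b2q p
pick-unit true  _     = refl
pick-unit false true  = refl
pick-unit false false = refl

pick-zero : ∀ p q → pick p q ⟨ 0ℚ , 0ℚ , 0ℚ ⟩ ≡ 0ℚ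
pick-zero true  _     = refl
pick-zero false true  = refl
pick-zero false false = refl

pick-decomposition : ∀ p q T → p ∧ q ≡ false → pick p q T ≡ (self T - far T) * b2q p + (near T - far T) * b2q q + far T
pick-decomposition true  false ⟨ a , b , c ⟩ _ = at-self a b c
  where
  at-self : ∀ a b c → a ≡ (a - c) * 1ℚ + (b - c) * 0ℚ + c
  at-self = solve-∀ ℚ-ring
pick-decomposition false true  ⟨ a , b , c ⟩ _ = at-near a b c
  where
  at-near : ∀ a b c → b ≡ (a - c) * 0ℚ + (b - c) * 1ℚ + c
  at-near = solve-∀ ℚ-ring
pick-decomposition false false ⟨ a , b , c ⟩ _ = at-far a b c
  where
  at-far : ∀ a b c → c ≡ (a - c) * 0ℚ + (b - c) * 0ℚ + c
  at-far = solve-∀ ℚ-ring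

φ : CellVector → ℚ
φ ⟨ a , b , c ⟩ = a - ℕtoℚ 2 * b + c

φ-neg : ∀ T → φ (-ᶜ T) ≡ - φ T
φ-neg ⟨ a , b , c ⟩ = identity a b c
  where
  identity : ∀ a b c → - a - ℕtoℚ 2 * - b + - c ≡ - (a - ℕtoℚ 2 * b + c)
  identity = solve-∀ ℚ-ring

φ-+· : ∀ F s T → φ (F +ᶜ s ·ᶜ T) ≡ φ F + s * φ T
φ-+· ⟨ a , b , c ⟩ s ⟨ a′ , b′ , c′ ⟩ = identity a b c s a′ b′ c′
  where
  identity : ∀ a b c s a′ b′ c′ → a + s * a′ - ℕtoℚ 2 * (b + s * b′) + (c + s * c′)
                                 ≡ a - ℕtoℚ 2 * b + c + s * (a′ - ℕtoℚ 2 * b′ + c′)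
  identity = solve-∀ ℚ-ring

-- For the cocktail party parameters (k, λ, μ) = (l + 2, l, l + 2), φ is a left eigenvector of the
-- quotient matrix for the adjacency eigenvalue −2.
φ-cellA : ∀ {k l m} → l ℕ.+ 2 ≡ k → m ≡ k → ∀ T → φ (cellA k l m T) ≡ - (ℕtoℚ 2 * φ T)
φ-cellA {l = l} refl refl ⟨ a , b , c ⟩ rewrite ℕtoℚ-+ l 2 = identity a b c (ℕtoℚ l)
  where
  identity : ∀ a b c L → (L + ℕtoℚ 2) * b - ℕtoℚ 2 * (a + L * b + (L + ℕtoℚ 2 - 1ℚ - L) * c)
                           + ((L + ℕtoℚ 2) * b + (L + ℕtoℚ 2 - (L + ℕtoℚ 2)) * c)
                       ≡ - (ℕtoℚ 2 * (a - ℕtoℚ 2 * b + c))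
  identity = solve-∀ ℚ-ring

module CocktailOrbit {k′ l m : ℕ} (l+2≡k : l ℕ.+ 2 ≡ suc k′) (m≡k : m ≡ suc k′) where

  K r u : ℚ
  K = ℕtoℚ (suc k′)
  r = recip (suc k′)
  u = - (ℕtoℚ 4 * r)

  F H : ℕ → CellVector
  F t = proj₁ (orbit (suc k′) l m t)
  H t = proj₂ (orbit (suc k′) l m t)

  φH-rec : ∀ t → φ (H (suc t)) ≡ φ (F t) + u * φ (H t)
  φH-rec t = begin
    φ (F t +ᶜ (ℕtoℚ 2 * r) ·ᶜ cellA (suc k′) l m (H t))
      ≡⟨ φ-+· (F t) (ℕtoℚ 2 * r) (cellA (suc k′) l m (H t)) ⟩
    φ (F t) + ℕtoℚ 2 * r * φ (cellA (suc k′) l m (H t))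
      ≡⟨ cong (λ z → φ (F t) + ℕtoℚ 2 * r * z) (φ-cellA l+2≡k m≡k (H t)) ⟩
    φ (F t) + ℕtoℚ 2 * r * - (ℕtoℚ 2 * φ (H t))
      ≡⟨ cong (_+_ (φ (F t))) (scale r (φ (H t))) ⟩
    φ (F t) + u * φ (H t) ∎
    where
    open ≡-Reasoning
    scale : ∀ r b → ℕtoℚ 2 * r * - (ℕtoℚ 2 * b) ≡ - (ℕtoℚ 4 * r) * b
    scale = solve-∀ ℚ-ring

  orbit-lucas : ∀ t → φ (F t) + φ (H (suc t)) ≡ lucas u t
  orbit-lucas = pair-recurrence⇒lucas u (φ ∘ F) (φ ∘ H) refl refl (λ t → φ-neg (H t)) φH-rec

  orbit-return : ∀ τ → ℕtoℚ 2 * r * φ (cellA (suc k′) l m (H τ) +ᶜ K ·ᶜ F τ) ≡ lucas u τ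
  orbit-return τ = begin
    ℕtoℚ 2 * r * φ (cellA (suc k′) l m (H τ) +ᶜ K ·ᶜ F τ)
      ≡⟨ cong (ℕtoℚ 2 * r *_) (φ-+· (cellA (suc k′) l m (H τ)) K (F τ)) ⟩
    ℕtoℚ 2 * r * (φ (cellA (suc k′) l m (H τ)) + K * φ (F τ))
      ≡⟨ cong (λ z → ℕtoℚ 2 * r * (z + K * φ (F τ))) (φ-cellA l+2≡k m≡k (H τ)) ⟩
    ℕtoℚ 2 * r * (- (ℕtoℚ 2 * φ (H τ)) + K * φ (F τ))
      ≡⟨ regroup r K (φ (F τ)) (φ (H τ)) ⟩
    φ (F τ) + (φ (F τ) + u * φ (H τ)) + ℕtoℚ 2 * φ (F τ) * (r * K - 1ℚ)
      ≡⟨ cong (λ z → φ (F τ) + (φ (F τ) + u * φ (H τ)) + ℕtoℚ 2 * φ (F τ) * (z - 1ℚ)) (recip-inverse k′) ⟩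
    φ (F τ) + (φ (F τ) + u * φ (H τ)) + ℕtoℚ 2 * φ (F τ) * (1ℚ - 1ℚ)
      ≡⟨ cancel (φ (F τ) + (φ (F τ) + u * φ (H τ))) (φ (F τ)) ⟩
    φ (F τ) + (φ (F τ) + u * φ (H τ))                           ≡⟨ cong (_+_ (φ (F τ))) (φH-rec τ) ⟨
    φ (F τ) + φ (H (suc τ))                                     ≡⟨ orbit-lucas τ ⟩
    lucas u τ                                                   ∎
    where
    open ≡-Reasoning
    regroup : ∀ r K a b → ℕtoℚ 2 * r * (- (ℕtoℚ 2 * b) + K * a) ≡ a + (a + - (ℕtoℚ 4 * r) * b) + ℕtoℚ 2 * a * (r * K - 1ℚ)
    regroup = solve-∀ ℚ-ring
    cancel : ∀ x a → x + ℕtoℚ 2 * a * (1ℚ - 1ℚ) ≡ x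
    cancel = solve-∀ ℚ-ring

-- Strongly regular graphs: the walk from χ_x stays cell-constant

module EquitablePartition {n : ℕ} (G : Graph n) (k′ : ℕ) (regular : ∀ x → deg G x ≡ suc k′)
  (l m : ℕ) (λ-param : ∀ x y → adj G x y ≡ true → common G x y ≡ l)
  (μ-param : ∀ x y → x ≢ y → adj G x y ≡ false → common G x y ≡ m) (x : Fin n) where
  open GroverWalk G public
  open Regular k′ regular public

  onCells : CellVector → Fin n → ℚ
  onCells T v = pick (v == x) (adj G x v) T

  onCells-self : ∀ T → onCells T x ≡ self T
  onCells-self T = cong (λ p → pick p (adj G x x) T) (==-refl x)

  onCells-near : ∀ T {v} → adj G x v ≡ true → onCells T v ≡ near T
  onCells-near T xv = cong₂ (λ p q → pick p q T) (==-≢ (adj⇒≢ G xv ∘ sym)) xv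

  onCells-far : ∀ T {v} → v ≢ x → adj G x v ≡ false → onCells T v ≡ far T
  onCells-far T v≢x xv = cong₂ (λ p q → pick p q T) (==-≢ v≢x) xv

  A-onCells : ∀ T v → A (onCells T) v ≡
    (self T - far T) * b2q (adj G v x) + (near T - far T) * ℕtoℚ (common G v x) + far T * K
  A-onCells T v = begin
    sumℚ (λ u → b2q (adj G v u) * onCells T u)
      ≡⟨ sumℚ-cong (λ u → trans (cong (b2q (adj G v u) *_) (pick-decomposition (u == x) (adj G x u) T (x-not-near u)))
                                (spread α β γ (b2q (adj G v u)) (b2q (u == x)) (b2q (adj G x u)))) ⟩
    sumℚ (λ u → α * (b2q (u == x) * b2q (adj G v u)) + β * (b2q (adj G v u) * b2q (adj G x u)) + γ * b2q (adj G v u))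
      ≡⟨ sumℚ-three α β γ (λ u → b2q (u == x) * b2q (adj G v u)) (λ u → b2q (adj G v u) * b2q (adj G x u))
                          (λ u → b2q (adj G v u)) ⟩
    α * sumℚ (λ u → b2q (u == x) * b2q (adj G v u)) + β * sumℚ (λ u → b2q (adj G v u) * b2q (adj G x u))
      + γ * sumℚ (λ u → b2q (adj G v u))
      ≡⟨ cong₂ _+_ (cong₂ (λ p q → α * p + β * q) (sumℚ-δ x (λ u → b2q (adj G v u))) common-sum) degree-sum ⟩
    α * b2q (adj G v x) + β * ℕtoℚ (common G v x) + γ * K ∎
    where
    open ≡-Reasoning
    α = self T - far T
    β = near T - far T
    γ = far T
    x-not-near : ∀ u → (u == x) ∧ adj G x u ≡ false
    x-not-near u with u == x in u≡x
    ... | false = refl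
    ... | true rewrite ==⇒≡ u≡x = irrefl G x
    spread : ∀ α β γ w δ q → w * (α * δ + β * q + γ) ≡ α * (δ * w) + β * (w * q) + γ * w
    spread = solve-∀ ℚ-ring
    common-sum : sumℚ (λ u → b2q (adj G v u) * b2q (adj G x u)) ≡ ℕtoℚ (common G v x)
    common-sum = trans (sumℚ-cong (λ u → sym (b2q-∧ (adj G v u) (adj G x u)))) (sym (ℕtoℚ-count (λ u → adj G v u ∧ adj G x u)))
    degree-sum : γ * sumℚ (λ u → b2q (adj G v u)) ≡ γ * K
    degree-sum = cong (γ *_) (trans (sym (ℕtoℚ-count (adj G v))) (cong ℕtoℚ (regular v)))

  A-onCells-cellA : ∀ T v → A (onCells T) v ≡ onCells (cellA (suc k′) l m T) v
  A-onCells-cellA T@(⟨ a , b , c ⟩) v with v == x in v≡x | adj G x v in xv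
  ... | true | _ rewrite ==⇒≡ v≡x = begin
    A (onCells T) x                                                     ≡⟨ A-onCells T x ⟩
    (a - c) * b2q (adj G x x) + (b - c) * ℕtoℚ (common G x x) + c * K   ≡⟨ cong₂ (λ p d → (a - c) * b2q p + (b - c) * ℕtoℚ d + c * K)
                                                                                  (irrefl G x) (trans (common-self G x) (regular x)) ⟩
    (a - c) * 0ℚ + (b - c) * K + c * K                                  ≡⟨ at-self a b c K ⟩
    K * b                                                               ∎
    where
    open ≡-Reasoning
    at-self : ∀ a b c K → (a - c) * 0ℚ + (b - c) * K + c * K ≡ K * b
    at-self = solve-∀ ℚ-ring
  ... | false | true = begin
    A (onCells T) v                                                     ≡⟨ A-onCells T v ⟩
    (a - c) * b2q (adj G v x) + (b - c) * ℕtoℚ (common G v x) + c * K   ≡⟨ cong₂ (λ p d → (a - c) * b2q p + (b - c) * ℕtoℚ d + c * K)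
                                                                                  vx (λ-param v x vx) ⟩
    (a - c) * 1ℚ + (b - c) * ℕtoℚ l + c * K                             ≡⟨ at-near a b c K (ℕtoℚ l) ⟩
    a + ℕtoℚ l * b + (K - 1ℚ - ℕtoℚ l) * c                              ∎
    where
    open ≡-Reasoning
    vx : adj G v x ≡ true
    vx = trans (symm G v x) xv
    at-near : ∀ a b c K L → (a - c) * 1ℚ + (b - c) * L + c * K ≡ a + L * b + (K - 1ℚ - L) * c
    at-near = solve-∀ ℚ-ring
  ... | false | false = begin
    A (onCells T) v                                                     ≡⟨ A-onCells T v ⟩
    (a - c) * b2q (adj G v x) + (b - c) * ℕtoℚ (common G v x) + c * K   ≡⟨ cong₂ (λ p d → (a - c) * b2q p + (b - c) * ℕtoℚ d + c * K)
                                                                                  vx (μ-param v x (==-false⇒≢ v≡x) vx) ⟩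
    (a - c) * 0ℚ + (b - c) * ℕtoℚ m + c * K                             ≡⟨ at-far a b c K (ℕtoℚ m) ⟩
    ℕtoℚ m * b + (K - ℕtoℚ m) * c                                       ∎
    where
    open ≡-Reasoning
    vx : adj G v x ≡ false
    vx = trans (symm G v x) xv
    at-far : ∀ a b c K M → (a - c) * 0ℚ + (b - c) * M + c * K ≡ M * b + (K - M) * c
    at-far = solve-∀ ℚ-ring

  orbit-split : ∀ τ → Split (Upow G τ (χ G x)) (onCells (proj₁ (orbit (suc k′) l m τ))) (onCells (proj₂ (orbit (suc k′) l m τ)))
  orbit-split zero = split-cong (χ-split x) (λ w → sym (pick-unit (w == x) (adj G x w))) (λ w → sym (pick-zero (w == x) (adj G x w)))
  orbit-split (suc τ) = split-cong (U-split (orbit-split τ))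
    (λ w → sym (pick-neg (w == x) (adj G x w) H))
    (λ w → trans (cong (λ q → onCells F w + ℕtoℚ 2 * r * q) (A-onCells-cellA H w))
                 (sym (pick-+· (w == x) (adj G x w) F (ℕtoℚ 2 * r) (cellA (suc k′) l m H))))
    where
    F = proj₁ (orbit (suc k′) l m τ)
    H = proj₂ (orbit (suc k′) l m τ)

-- Perfect state transfer forces K_{2,2} or K_{2,2,2}

module TransferAnalysis {n : ℕ} (G : Graph n) (k′ : ℕ) (regular : ∀ x → deg G x ≡ suc k′)
  (l m : ℕ) (λ-param : ∀ x y → adj G x y ≡ true → common G x y ≡ l)
  (μ-param : ∀ x y → x ≢ y → adj G x y ≡ false → common G x y ≡ m)
  {x y : Fin n} (x≢y : x ≢ y) {τ : ℕ} {c : ℚ}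
  (c²-deg : c * c * ℕtoℚ (deg G y) ≡ ℕtoℚ (deg G x))
  (transfer : ∀ a → Upow G τ (χ G x) a ≡ c * χ G y a) where
  open EquitablePartition G k′ regular l m λ-param μ-param x

  F H Ĥ : CellVector
  F = proj₁ (orbit (suc k′) l m τ)
  H = proj₂ (orbit (suc k′) l m τ)
  Ĥ = cellA (suc k′) l m H +ᶜ K ·ᶜ F

  arrival : ∀ w → onCells Ĥ w ≡ K * (c * b2q (w == y))
  arrival w = begin
    onCells Ĥ w                                 ≡⟨ pick-+· (w == x) (adj G x w) (cellA (suc k′) l m H) K F ⟩
    onCells (cellA (suc k′) l m H) w + K * onCells F w ≡⟨ cong (_+ K * onCells F w) (A-onCells-cellA H w) ⟨
    A (onCells H) w + K * onCells F w           ≡⟨ ℚP.+-comm (A (onCells H) w) (K * onCells F w) ⟩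
    K * onCells F w + A (onCells H) w           ≡⟨ split-target c y (orbit-split τ) transfer w ⟩
    K * (c * b2q (w == y))                      ∎
    where open ≡-Reasoning

  c²≡1 : c * c ≡ 1ℚ
  c²≡1 = begin
    c * c                   ≡⟨ ℚP.*-identityʳ (c * c) ⟨
    c * c * 1ℚ              ≡⟨ cong (c * c *_) (trans (ℚP.*-comm K r) (recip-inverse k′)) ⟨
    c * c * (K * r)         ≡⟨ ℚP.*-assoc (c * c) K r ⟨
    c * c * K * r           ≡⟨ cong (λ d → c * c * ℕtoℚ d * r) (regular y) ⟨
    c * c * ℕtoℚ (deg G y) * r ≡⟨ cong (_* r) (trans c²-deg (cong ℕtoℚ (regular x))) ⟩
    K * r                   ≡⟨ trans (ℚP.*-comm K r) (recip-inverse k′) ⟩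
    1ℚ                      ∎
    where open ≡-Reasoning

  Kc≢0 : K * c ≢ 0ℚ
  Kc≢0 Kc≡0 = contradiction (begin
    1ℚ                      ≡⟨ cong₂ _*_ (recip-inverse k′) c²≡1 ⟨
    r * K * (c * c)         ≡⟨ regroup r K c ⟩
    (K * c) * (r * c)       ≡⟨ cong (_* (r * c)) Kc≡0 ⟩
    0ℚ * (r * c)            ≡⟨ ℚP.*-zeroˡ (r * c) ⟩
    0ℚ                      ∎) λ ()
    where
    open ≡-Reasoning
    regroup : ∀ r K c → r * K * (c * c) ≡ (K * c) * (r * c)
    regroup = solve-∀ ℚ-ring

  arrival-at-y : onCells Ĥ y ≡ K * c
  arrival-at-y = trans (arrival y) (trans (cong (λ b → K * (c * b2q b)) (==-refl y)) (cong (K *_) (ℚP.*-identityʳ c)))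

  arrival-elsewhere : ∀ w → w ≢ y → onCells Ĥ w ≡ 0ℚ
  arrival-elsewhere w w≢y = trans (arrival w) (trans (cong (λ b → K * (c * b2q b)) (==-≢ w≢y))
                                                     (trans (cong (K *_) (ℚP.*-zeroʳ c)) (ℚP.*-zeroʳ K)))

  same-cell-as-y : ∀ w → (w == x) ≡ (y == x) → adj G x w ≡ adj G x y → w ≡ y
  same-cell-as-y w wx xw with w ≟ᶠ y
  ... | yes w≡y = w≡y
  ... | no w≢y  = contradiction (begin
    K * c         ≡⟨ arrival-at-y ⟨
    onCells Ĥ y   ≡⟨ cong₂ (λ p q → pick p q Ĥ) (sym wx) (sym xw) ⟩
    onCells Ĥ w   ≡⟨ arrival-elsewhere w w≢y ⟩
    0ℚ            ∎) Kc≢0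
    where open ≡-Reasoning

  neighbours-of-x : adj G x y ≡ true → ∀ z → adj G x z ≡ true → z ≡ y
  neighbours-of-x xy z xz = same-cell-as-y z (trans (==-≢ (adj⇒≢ G xz ∘ sym)) (sym (==-≢ (adj⇒≢ G xy ∘ sym)))) (trans xz (sym xy))

  non-neighbours-of-x : adj G x y ≡ false → ∀ z → z ≢ x → adj G x z ≡ false → z ≡ y
  non-neighbours-of-x xy z z≢x xz = same-cell-as-y z (trans (==-≢ z≢x) (sym (==-≢ (x≢y ∘ sym)))) (trans xz (sym xy))

  φ-arrival : ∀ {v} → adj G x v ≡ true → adj G x y ≡ false → φ Ĥ ≡ K * c
  φ-arrival {v} xv xy = begin
    self Ĥ - ℕtoℚ 2 * near Ĥ + far Ĥ    ≡⟨ cong₂ (λ a b → a - ℕtoℚ 2 * b + far Ĥ) self≡0 near≡0 ⟩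
    0ℚ - ℕtoℚ 2 * 0ℚ + far Ĥ            ≡⟨ drop-zeros (far Ĥ) ⟩
    far Ĥ                               ≡⟨ far≡Kc ⟩
    K * c                               ∎
    where
    open ≡-Reasoning
    drop-zeros : ∀ z → 0ℚ - ℕtoℚ 2 * 0ℚ + z ≡ z
    drop-zeros = solve-∀ ℚ-ring
    self≡0 : self Ĥ ≡ 0ℚ
    self≡0 = trans (sym (onCells-self Ĥ)) (arrival-elsewhere x x≢y)
    near≡0 : near Ĥ ≡ 0ℚ
    near≡0 = trans (sym (onCells-near Ĥ xv)) (arrival-elsewhere v λ { refl → contradiction (trans (sym xv) xy) λ () })
    far≡Kc : far Ĥ ≡ K * c
    far≡Kc = trans (sym (onCells-far Ĥ (x≢y ∘ sym) xy)) arrival-at-y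

  lucas-returns-to-±2 : l ℕ.+ 2 ≡ suc k′ → m ≡ suc k′ → ∀ {v} → adj G x v ≡ true → adj G x y ≡ false →
                        lucas (- (ℕtoℚ 4 * r)) τ * lucas (- (ℕtoℚ 4 * r)) τ ≡ ℕtoℚ 4
  lucas-returns-to-±2 l+2≡k m≡k xv xy = begin
    lucas u τ * lucas u τ             ≡⟨ cong (λ z → z * z) lucas≡2c ⟩
    ℕtoℚ 2 * c * (ℕtoℚ 2 * c)         ≡⟨ square c ⟩
    ℕtoℚ 4 * (c * c)                  ≡⟨ cong (ℕtoℚ 4 *_) c²≡1 ⟩
    ℕtoℚ 4 * 1ℚ                       ≡⟨ ℚP.*-identityʳ (ℕtoℚ 4) ⟩
    ℕtoℚ 4                            ∎
    where
    open ≡-Reasoning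
    u = - (ℕtoℚ 4 * r)
    square : ∀ c → ℕtoℚ 2 * c * (ℕtoℚ 2 * c) ≡ ℕtoℚ 4 * (c * c)
    square = solve-∀ ℚ-ring
    regroup : ∀ r K c → ℕtoℚ 2 * r * (K * c) ≡ ℕtoℚ 2 * (r * K) * c
    regroup = solve-∀ ℚ-ring
    lucas≡2c : lucas u τ ≡ ℕtoℚ 2 * c
    lucas≡2c = begin
      lucas u τ                  ≡⟨ CocktailOrbit.orbit-return l+2≡k m≡k τ ⟨
      ℕtoℚ 2 * r * φ Ĥ           ≡⟨ cong (ℕtoℚ 2 * r *_) (φ-arrival xv xy) ⟩
      ℕtoℚ 2 * r * (K * c)       ≡⟨ regroup r K c ⟩
      ℕtoℚ 2 * (r * K) * c       ≡⟨ cong (λ z → ℕtoℚ 2 * z * c) (recip-inverse k′) ⟩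
      ℕtoℚ 2 * 1ℚ * c            ≡⟨ cong (_* c) (ℚP.*-identityʳ (ℕtoℚ 2)) ⟩
      ℕtoℚ 2 * c                 ∎

module Forward {n : ℕ} (G : Graph n) (positive : ∀ x → 0 < deg G x) (connected : Connected G)
  (not-complete : ∃[ x ] ∃[ y ] (x ≢ y × adj G x y ≡ false))
  (k′ : ℕ) (regular : ∀ x → deg G x ≡ suc k′) (l m : ℕ)
  (λ-param : ∀ x y → adj G x y ≡ true → common G x y ≡ l)
  (μ-param : ∀ x y → x ≢ y → adj G x y ≡ false → common G x y ≡ m) where

  k′≢0 : k′ ≢ 0
  k′≢0 refl = let p , q , p≢q , pq = not-complete in
    contradiction (trans (sym pq) (connected-1-regular⇒complete G regular connected p q p≢q)) λ ()

  cocktailParty : ∀ {x y} → y ≢ x → (∀ z → adj G x z ≡ not (any (z ==_) (x ∷ y ∷ []))) → CocktailParty (adj G)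
  cocktailParty {x} y≢x adj≡ = cocktailParty-from-degree G λ u →
    trans (cong (ℕ._+ 2) (trans (regular u) (sym (regular x)))) (deg-of-mate G y≢x adj≡)

  module _ (C : CocktailParty (adj G)) {x v : Fin n} (xv : adj G x v ≡ true) where
    open CocktailPartyGraph G C

    size : n ≡ suc k′ ℕ.+ 2
    size = trans (sym (deg+2 x)) (cong (ℕ._+ 2) (regular x))

    K22-from-edge : suc k′ ≡ 2 → IsomorphicTo G K22
    K22-from-edge k≡2 = CocktailPartyClique.complete-multipartite G C (edge G x v) (edge-clique G xv)
                          (trans size (cong (ℕ._+ 2) k≡2)) K22-parts

    K222-from-edge : suc k′ ≡ 4 → IsomorphicTo G K222
    K222-from-edge k≡4 = CocktailPartyClique.complete-multipartite G C (triangle G x v w) (triangle-clique G xv xw vw)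
                           (trans size (cong (ℕ._+ 2) k≡4)) K222-parts
      where
      common≡2 : common G x v ≡ 2
      common≡2 = ℕP.+-cancelʳ-≡ 2 (common G x v) 2 (trans (common-adjacent+2 xv) (trans (regular x) k≡4))
      witness : ∃ λ w → adj G x w ∧ adj G v w ≡ true
      witness = count-witness (λ z → adj G x z ∧ adj G v z) (subst (0 <_) (sym common≡2) (s≤s z≤n))
      w : Fin n
      w = proj₁ witness
      xw : adj G x w ≡ true
      xw = proj₁ (∧-true (proj₂ witness))
      vw : adj G v w ≡ true
      vw = proj₂ (∧-true (proj₂ witness))

  pst⇒K22⊎K222 : AdmitsPST G → IsomorphicTo G K22 ⊎ IsomorphicTo G K222
  pst⇒K22⊎K222 (x , y , x≢y , suc t , _ , c , c²-deg , transfer) with adj G x y in xy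
  ... | true =
    contradiction (ℕP.n≤0⇒n≡0 (ℕP.≤-pred (subst (_≤ 1) (regular x) (unique-neighbour⇒deg≤1 G (neighbours-of-x xy))))) k′≢0
    where open TransferAnalysis G k′ regular l m λ-param μ-param x≢y {suc t} {c} c²-deg transfer
  ... | false = by-degree (suc k′ ℕ.≟ 2) (suc k′ ℕ.≟ 4)
    where
    open TransferAnalysis G k′ regular l m λ-param μ-param x≢y {suc t} {c} c²-deg transfer
    C : CocktailParty (adj G)
    C = cocktailParty (x≢y ∘ sym) (adj-of-unique-nonneighbour G xy (non-neighbours-of-x xy))
    open CocktailPartyGraph G C
    v : Fin n
    v = proj₁ (neighbour-exists G x (positive x))
    xv : adj G x v ≡ true
    xv = proj₂ (neighbour-exists G x (positive x))
    l+2≡k : l ℕ.+ 2 ≡ suc k′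
    l+2≡k = trans (cong (ℕ._+ 2) (sym (λ-param x v xv))) (trans (common-adjacent+2 xv) (regular x))
    m≡k : m ≡ suc k′
    m≡k = trans (sym (μ-param x y x≢y xy)) (trans (common-nonadjacent x≢y xy) (regular x))
    by-degree : Dec (suc k′ ≡ 2) → Dec (suc k′ ≡ 4) → IsomorphicTo G K22 ⊎ IsomorphicTo G K222
    by-degree (yes k≡2) _         = inj₁ (K22-from-edge C xv k≡2)
    by-degree (no _)    (yes k≡4) = inj₂ (K222-from-edge C xv k≡4)
    by-degree (no k≢2)  (no k≢4)
      with p , q , 4q≡pk , 2≤q , coprime ← four-over-lowest-terms (suc k′) (λ ()) (k′≢0 ∘ ℕP.suc-injective) k≢2 k≢4 =
      contradiction (lucas-returns-to-±2 l+2≡k m≡k xv xy)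
                    (lucas-square≢4 2≤q coprime (lowest-terms⇒lucas-parameter {p} {q} {k′} 4q≡pk) t)

-- Perfect state transfer in K_{2,2} and K_{2,2,2}

module Backward {n : ℕ} (G : Graph n) (C : CocktailParty (adj G)) (k′ l : ℕ)
  (size : n ≡ suc k′ ℕ.+ 2) (l+2≡k : l ℕ.+ 2 ≡ suc k′) (x : Fin n) where
  open CocktailPartyGraph G C

  regular : ∀ u → deg G u ≡ suc k′
  regular u = ℕP.+-cancelʳ-≡ 2 (deg G u) (suc k′) (trans (deg+2 u) size)

  λ-param : ∀ u v → adj G u v ≡ true → common G u v ≡ l
  λ-param u v uv = ℕP.+-cancelʳ-≡ 2 (common G u v) l (trans (common-adjacent+2 uv) (trans (regular u) (sym l+2≡k)))

  μ-param : ∀ u v → u ≢ v → adj G u v ≡ false → common G u v ≡ suc k′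
  μ-param u v u≢v uv = trans (common-nonadjacent u≢v uv) (regular u)

  open EquitablePartition G k′ regular l (suc k′) λ-param μ-param x

  data Cell (w : Fin n) : Set where
    at-x    : w ≡ x → Cell w
    near-x  : adj G x w ≡ true → Cell w
    at-mate : w ≡ mate x → Cell w

  cell : ∀ w → Cell w
  cell w with w ≟ᶠ x | adj G x w in xw
  ... | yes w≡x | _     = at-x w≡x
  ... | no _    | true  = near-x xw
  ... | no w≢x  | false = at-mate (nonadjacent⇒mate w≢x xw)

  -- F (t a) + H (o a) = δ_{mate x} (t a) on every kind of arc a.
  LandsOnMate : ℕ → Set
  LandsOnMate τ = self F + near H ≡ 0ℚ × near F + self H ≡ 0ℚ × near F + far H ≡ 0ℚ × far F + near H ≡ 1ℚ
                × (l ≡ 0 ⊎ near F + near H ≡ 0ℚ)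
    where
    F = proj₁ (orbit (suc k′) l (suc k′) τ)
    H = proj₂ (orbit (suc k′) l (suc k′) τ)

  transfer-from-orbit : ∀ τ → LandsOnMate τ → ∀ a → Upow G τ (χ G x) a ≡ 1ℚ * χ G (mate x) a
  transfer-from-orbit τ (x←N , N←x , N←mate , mate←N , N←N) a@((u , w) , uw) =
    trans (Split.at (orbit-split τ) a) (arc (cell w) (cell u))
    where
    F = proj₁ (orbit (suc k′) l (suc k′) τ)
    H = proj₂ (orbit (suc k′) l (suc k′) τ)
    w≢mate : adj G x w ≡ true → w ≢ mate x
    w≢mate xw refl = contradiction (trans (sym xw) (mate-nonadjacent x)) λ ()
    not-mate : w ≢ mate x → 0ℚ ≡ 1ℚ * b2q (w == mate x)
    not-mate w≢mate = cong (λ b → 1ℚ * b2q b) (sym (==-≢ w≢mate))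
    no-loop : ∀ {A : Set} {z} → u ≡ z → w ≡ z → A
    no-loop refl refl = contradiction (trans (sym uw) (irrefl G u)) λ ()
    no-edge : ∀ {A : Set} {a b} → adj G a b ≡ false → a ≡ u → b ≡ w → A
    no-edge ab refl refl = contradiction (trans (sym uw) ab) λ ()
    arc : Cell w → Cell u → onCells F w + onCells H u ≡ 1ℚ * b2q (w == mate x)
    arc (at-x w≡x)       (at-x u≡x)       = no-loop u≡x w≡x
    arc (at-x refl)      (near-x xu)      = trans (cong₂ _+_ (onCells-self F) (onCells-near H xu)) (trans x←N (not-mate (mate-≢ x ∘ sym)))
    arc (at-x refl)      (at-mate refl)   = no-edge (trans (symm G (mate x) x) (mate-nonadjacent x)) refl refl
    arc (near-x xw)      (at-x refl)      = trans (cong₂ _+_ (onCells-near F xw) (onCells-self H)) (trans N←x (not-mate (w≢mate xw)))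
    arc (near-x xw)      (near-x xu)      = [ no-triangle , both-near ]′ N←N
      where
      no-triangle : l ≡ 0 → onCells F w + onCells H u ≡ 1ℚ * b2q (w == mate x)
      no-triangle l≡0 = contradiction (subst (1 ≤_) (trans (λ-param x w xw) l≡0) u-is-common) λ ()
        where
        u-is-common : 1 ≤ common G x w
        u-is-common = count-≥1 {P = λ z → adj G x z ∧ adj G w z} (cong₂ _∧_ xu (trans (symm G w u) uw))
      both-near : near F + near H ≡ 0ℚ → onCells F w + onCells H u ≡ 1ℚ * b2q (w == mate x)
      both-near N←N′ = trans (cong₂ _+_ (onCells-near F xw) (onCells-near H xu)) (trans N←N′ (not-mate (w≢mate xw)))
    arc (near-x xw)      (at-mate refl)   = trans (cong₂ _+_ (onCells-near F xw) (onCells-far H (mate-≢ x) (mate-nonadjacent x)))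
                                                  (trans N←mate (not-mate (w≢mate xw)))
    arc (at-mate refl)   (at-x refl)      = no-edge (mate-nonadjacent x) refl refl
    arc (at-mate refl)   (near-x xu)      = trans (cong₂ _+_ (onCells-far F (mate-≢ x) (mate-nonadjacent x)) (onCells-near H xu))
                                                  (trans mate←N (cong (λ b → 1ℚ * b2q b) (sym (==-refl (mate x)))))
    arc (at-mate w≡mate) (at-mate u≡mate) = no-loop u≡mate w≡mate

  mate-pst : ∀ τ → 1 ≤ τ → LandsOnMate τ → AdmitsPST G
  mate-pst τ 1≤τ lands = x , mate x , mate-≢ x ∘ sym , τ , 1≤τ , 1ℚ , same-degree , transfer-from-orbit τ lands
    where
    same-degree : 1ℚ * 1ℚ * ℕtoℚ (deg G (mate x)) ≡ ℕtoℚ (deg G x)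
    same-degree = trans (ℚP.*-identityˡ _) (cong ℕtoℚ (trans (regular (mate x)) (sym (regular x))))

-- orbit 2 0 2 2 = (⟨ -1 , 0 , 0 ⟩ , ⟨ 0 , 1 , 0 ⟩)
K22⇒pst : ∀ {n} (G : Graph n) → IsomorphicTo G K22 → AdmitsPST G
K22⇒pst G iso@(f , _) = Backward.mate-pst G (cocktailParty-transport G iso K22-cocktailParty) 1 0 (↔-size f) refl
                          (Inverse.from f zero) 2 (s≤s z≤n) (refl , refl , refl , refl , inj₁ refl)

-- orbit 4 2 4 6 = (⟨ -1 , -1 , 0 ⟩ , ⟨ 1 , 1 , 1 ⟩)
K222⇒pst : ∀ {n} (G : Graph n) → IsomorphicTo G K222 → AdmitsPST G
K222⇒pst G iso@(f , _) = Backward.mate-pst G (cocktailParty-transport G iso K222-cocktailParty) 3 2 (↔-size f) refl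
                           (Inverse.from f zero) 6 (s≤s z≤n) (refl , refl , refl , refl , inj₂ refl)

theorem3p6 : ∀ {n : ℕ} (G : Graph n)
             → (∀ x → 0 < deg G x)
             → Connected G
             → StronglyRegular G
             → (AdmitsPST G ⇔ (IsomorphicTo G K22 ⊎ IsomorphicTo G K222))
theorem3p6 G positive connected (zero , _ , _ , (x , _) , _ , regular , _) =
  contradiction (subst (0 <_) (regular x) (positive x)) λ ()
theorem3p6 G positive connected (suc k′ , l , m , not-complete , _ , regular , λ-param , μ-param) =
  mk⇔ (Forward.pst⇒K22⊎K222 G positive connected not-complete k′ regular l m λ-param μ-param)
      [ K22⇒pst G , K222⇒pst G ]′
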